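{- For all positive integers $n$, $|S_n(\alpha_1,\alpha_2,\tau)|=\binom{n}{2}+1$ in each of the following cases: (1) $\alpha_1=123$, $\alpha_2=231$, and $\tau\in S_4$ contains $123$ or $231$; (2) $\alpha_1=123$, $\alpha_2\in\{132,213\}$, and $\tau\in\{3412,4231\}$; (3) $(\alpha_1,\alpha_2,\tau)=(132,213,3412)$; (4) $\alpha_1=132$, $\alpha_2=231$, and $\tau\in\{1234,2134,3124,3214\}$; (5) $(\alpha_1,\alpha_2,\tau)=(213,312,2341)$; (6) $\alpha_1=213$, $\alpha_2=321$, and $\tau\in\{1324,2314\}$; (7) $(\alpha_1,\alpha_2,\tau)=(213,132,4321)$.
   Context: Permutations are written in one-line notation. For $\pi\in S_n$ and $\sigma\in S_k$, $\pi$ contains $\sigma$ if there are indices $1\le i_1<\dots<i_k\le n$ such that $(\pi_{i_1},\dots,\pi_{i_k})$ is order-isomorphic to $\sigma$ (i.e. $\pi_{i_a}<\pi_{i_b}$ iff $\sigma_a<\sigma_b$); otherwise $\pi$ avoids $\sigma$. $S_n(\sigma_1,\sigma_2,\sigma_3)$ denotes the set of permutations in $S_n$ avoiding each of $\sigma_1,\sigma_2,\sigma_3$. -}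

module Defs where

open import Data.Nat using (ℕ; zero; suc; _+_)
open import Data.Nat.Combinatorics using (_C_)
open import Data.Fin using (Fin; _<_)
open import Data.Vec using (Vec; lookup; _∷_; [])
open import Data.Product using (Σ; ∃; _×_)
open import Data.Sum using (_⊎_)
open import Relation.Nullary using (¬_)
open import Relation.Binary.PropositionalEquality using (_≡_)
open import Function.Definitions using (Injective)
open import Function.Bundles using (_↔_)
open import Data.Fin using (#_)

-- A permutation of [n] in one-line notation: a vector (π₁,…,πₙ) of elements
-- of Fin n (values 0..n-1 stand for 1..n) whose entries are pairwise distinct
-- (hence a bijection, since the set is finite).
IsPerm : ∀ {n} → Vec (Fin n) n → Set
IsPerm π = Injective _≡_ _≡_ (lookup π)

Contains : ∀ {n k} → Vec (Fin n) n → Vec (Fin k) k → Set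
Contains {n} {k} π σ =
  Σ (Fin k → Fin n) λ ι →
    (∀ a b → a < b → ι a < ι b) ×
    (∀ a b → (lookup π (ι a) < lookup π (ι b) → lookup σ a < lookup σ b)
           × (lookup σ a < lookup σ b → lookup π (ι a) < lookup π (ι b)))

Avoids : ∀ {n k} → Vec (Fin n) n → Vec (Fin k) k → Set
Avoids π σ = ¬ Contains π σ

-- S_n(σ₁,σ₂,σ₃): permutations of length n avoiding each σᵢ.  Proof fields are
-- irrelevant, so elements are determined by their one-line vector.
record Av3 (n : ℕ) {a b c : ℕ} (σ₁ : Vec (Fin a) a) (σ₂ : Vec (Fin b) b)
           (σ₃ : Vec (Fin c) c) : Set where
  constructor av
  field
    perm : Vec (Fin n) n
    .isPerm : IsPerm perm
    .av₁ : Avoids perm σ₁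
    .av₂ : Avoids perm σ₂
    .av₃ : Avoids perm σ₃

HasCard : ∀ (n : ℕ) {a b c} → Vec (Fin a) a → Vec (Fin b) b → Vec (Fin c) c → ℕ → Set
HasCard n σ₁ σ₂ σ₃ m = Av3 n σ₁ σ₂ σ₃ ↔ Fin m

-- Patterns, written with values 1..k shifted down to 0..k-1.
p123 p132 p213 p231 p312 p321 : Vec (Fin 3) 3
p123 = (# 0) ∷ (# 1) ∷ (# 2) ∷ []
p132 = (# 0) ∷ (# 2) ∷ (# 1) ∷ []
p213 = (# 1) ∷ (# 0) ∷ (# 2) ∷ []
p231 = (# 1) ∷ (# 2) ∷ (# 0) ∷ []
p312 = (# 2) ∷ (# 0) ∷ (# 1) ∷ []
p321 = (# 2) ∷ (# 1) ∷ (# 0) ∷ []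

p3412 p4231 p1234 p2134 p3124 p3214 p2341 p1324 p2314 p4321 : Vec (Fin 4) 4
p3412 = (# 2) ∷ (# 3) ∷ (# 0) ∷ (# 1) ∷ []
p4231 = (# 3) ∷ (# 1) ∷ (# 2) ∷ (# 0) ∷ []
p1234 = (# 0) ∷ (# 1) ∷ (# 2) ∷ (# 3) ∷ []
p2134 = (# 1) ∷ (# 0) ∷ (# 2) ∷ (# 3) ∷ []
p3124 = (# 2) ∷ (# 0) ∷ (# 1) ∷ (# 3) ∷ []
p3214 = (# 2) ∷ (# 1) ∷ (# 0) ∷ (# 3) ∷ []
p2341 = (# 1) ∷ (# 2) ∷ (# 3) ∷ (# 0) ∷ []
p1324 = (# 0) ∷ (# 2) ∷ (# 1) ∷ (# 3) ∷ []
p2314 = (# 1) ∷ (# 2) ∷ (# 0) ∷ (# 3) ∷ []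
p4321 = (# 3) ∷ (# 2) ∷ (# 1) ∷ (# 0) ∷ []

data Case : Vec (Fin 3) 3 → Vec (Fin 3) 3 → Vec (Fin 4) 4 → Set where
  case1 : ∀ τ → IsPerm τ → Contains τ p123 ⊎ Contains τ p231 → Case p123 p231 τ
  case2a : Case p123 p132 p3412
  case2b : Case p123 p132 p4231
  case2c : Case p123 p213 p3412
  case2d : Case p123 p213 p4231
  case3 : Case p132 p213 p3412
  case4a : Case p132 p231 p1234
  case4b : Case p132 p231 p2134
  case4c : Case p132 p231 p3124
  case4d : Case p132 p231 p3214
  case5 : Case p213 p312 p2341
  case6a : Case p213 p321 p1324
  case6b : Case p213 p321 p2314
  case7 : Case p213 p132 p4321

{-# OPTIONS --safe #-}
-- Up to reverse, complement and swapping α₁ with α₂, each class Av(α₁, α₂, τ) of the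
-- theorem is one of nine classes C whose members of length at least two arise in exactly
-- one way from shorter ones: by prepending a new maximum, or by one other operation
-- (appending a new maximum, or prepending a new entry just below the first entry, the
-- last entry or the maximum). One operation maps C into itself; the other produces the
-- rest of C exactly from a class C′, namely C with τ replaced by a pattern of length
-- three. C′ grows in the same way from a class C″ (a pattern of length two in place of τ,
-- or for Av(123, 132, 4231) the members of C′ ending with their maximum), and C″ from the
-- empty class. So the counts satisfy cᵢ(n + 1) = cᵢ(n) + cᵢ₋₁(n) with cᵢ(1) = 1, which
-- gives 1, n and C(n, 2) + 1 on the three levels.
module Submission where

open import Defs
open import Axiom.UniquenessOfIdentityProofs using (module Decidable⇒UIP)
open import Data.Bool using (true; false; T; if_then_else_)
open import Data.Empty using (⊥; ⊥-elim)
import Data.Empty.Irrelevant as Irrelevant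
open import Data.Fin as Fin using (Fin; zero; suc; toℕ; fromℕ; inject₁; punchIn; punchOut; opposite; _<_; #_)
import Data.Fin.Properties as Finₚ
open import Data.List as List using (List; []; _∷_; _++_; length)
import Data.List.Properties as Listₚ
open import Data.List.Membership.Propositional using (_∈_)
import Data.List.Membership.Propositional.Properties as ∈ₚ
import Data.List.Membership.Setoid.Properties as Setoid∈ₚ
import Data.List.Relation.Unary.All as All
open import Data.List.Relation.Unary.AllPairs using ([]; _∷_)
open import Data.List.Relation.Unary.Any as Any using (here; any?)
import Data.List.Relation.Unary.Any.Properties as Anyₚ
open import Data.List.Relation.Unary.Unique.Propositional using (Unique)
import Data.List.Relation.Unary.Unique.Propositional.Properties as Uniqueₚ
open import Data.Nat as ℕ using (ℕ; zero; suc; z≤n; s≤s; _+_; _≤_; _<ᵇ_)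
import Data.Nat.Properties as ℕₚ
open import Data.Nat.Combinatorics using (_C_; nC1≡n; nCk+nC[k+1]≡[n+1]C[k+1])
open import Data.Product using (Σ; ∃; _×_; _,_; proj₁; proj₂)
open import Data.Sum as Sum using (_⊎_; inj₁; inj₂)
open import Data.Unit using (tt)
open import Data.Vec using (Vec; []; _∷_; lookup; map; tabulate)
import Data.Vec.Properties as Vecₚ
open import Function using (_∘_; id)
open import Function.Bundles using (_↔_; mk↔ₛ′)
open import Function.Definitions using (Injective)
open import Function.Properties.Inverse using (↔-trans)
open import Relation.Binary.Definitions using (tri<; tri≈; tri>)
open import Relation.Binary.PropositionalEquality
open import Relation.Nullary using (¬_; Dec; yes; no)
open import Relation.Nullary.Decidable using (True; toWitness; _→-dec_)

Perm : ℕ → Set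
Perm n = Vec (Fin n) n

Increasing : ∀ {k n} → (Fin k → Fin n) → Set
Increasing ι = ∀ a b → a < b → ι a < ι b

record OrderIso {k m m′} (f : Fin k → Fin m) (g : Fin k → Fin m′) : Set where
  field
    to-<   : ∀ {a b} → f a < f b → g a < g b
    from-< : ∀ {a b} → g a < g b → f a < f b
open OrderIso

record Occurs {n m k K} (f : Fin n → Fin m) (g : Fin k → Fin K) : Set where
  constructor occurrence
  field
    positions  : Fin k → Fin n
    increasing : Increasing positions
    orderIso   : OrderIso (f ∘ positions) g
open Occurs

orderIso-refl : ∀ {k m} {f : Fin k → Fin m} → OrderIso f f
orderIso-refl = record { to-< = id ; from-< = id }

orderIso-sym : ∀ {k m m′} {f : Fin k → Fin m} {g : Fin k → Fin m′} → OrderIso f g → OrderIso g f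
orderIso-sym iso = record { to-< = from-< iso ; from-< = to-< iso }

orderIso-trans : ∀ {k m m′ m″} {f : Fin k → Fin m} {g : Fin k → Fin m′} {h : Fin k → Fin m″} →
  OrderIso f g → OrderIso g h → OrderIso f h
orderIso-trans fg gh = record { to-< = to-< gh ∘ to-< fg ; from-< = from-< fg ∘ from-< gh }

orderIso-∘ : ∀ {j k m m′} {f : Fin k → Fin m} {g : Fin k → Fin m′} (p : Fin j → Fin k) →
  OrderIso f g → OrderIso (f ∘ p) (g ∘ p)
orderIso-∘ p iso = record { to-< = to-< iso ; from-< = from-< iso }

orderIso-≗ : ∀ {k m} {f g : Fin k → Fin m} → (∀ a → f a ≡ g a) → OrderIso f g
orderIso-≗ eq = record
  { to-< = λ {a b} → subst₂ _<_ (eq a) (eq b) ; from-< = λ {a b} → subst₂ _<_ (sym (eq a)) (sym (eq b)) }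

orderIso-embed : ∀ {k m m′} {e : Fin m → Fin m′} →
  (∀ {u v} → u < v → e u < e v) → (∀ {u v} → e u < e v → u < v) →
  (f : Fin k → Fin m) → OrderIso f (e ∘ f)
orderIso-embed mono cancel f = record { to-< = mono ; from-< = cancel }

occurs-resp : ∀ {n m m′ k K K′} {f : Fin n → Fin m} {f′ : Fin n → Fin m′}
  {g : Fin k → Fin K} {g′ : Fin k → Fin K′} →
  OrderIso f f′ → OrderIso g g′ → Occurs f g → Occurs f′ g′
occurs-resp ff′ gg′ (occurrence ι inc iso) =
  occurrence ι inc (orderIso-trans (orderIso-trans (orderIso-∘ ι (orderIso-sym ff′)) iso) gg′)

occurs-refl : ∀ {n m} {f : Fin n → Fin m} → Occurs f f
occurs-refl = occurrence id (λ a b → id) orderIso-refl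

occurs-trans : ∀ {n m k K j J} {f : Fin n → Fin m} {g : Fin k → Fin K} {h : Fin j → Fin J} →
  Occurs f g → Occurs g h → Occurs f h
occurs-trans (occurrence ι ι-inc ι-iso) (occurrence κ κ-inc κ-iso) =
  occurrence (ι ∘ κ) (λ a b → ι-inc (κ a) (κ b) ∘ κ-inc a b) (orderIso-trans (orderIso-∘ κ ι-iso) κ-iso)

occurs-∘ˡ : ∀ {n n′ m k K} {f : Fin n → Fin m} {g : Fin k → Fin K} {p : Fin n′ → Fin n} →
  Increasing p → Occurs (f ∘ p) g → Occurs f g
occurs-∘ˡ {p = p} p-inc (occurrence ι inc iso) = occurrence (p ∘ ι) (λ a b → p-inc (ι a) (ι b) ∘ inc a b) iso

occurs-∘ʳ : ∀ {n m k k′ K} {f : Fin n → Fin m} {g : Fin k → Fin K} {p : Fin k′ → Fin k} →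
  Increasing p → Occurs f g → Occurs f (g ∘ p)
occurs-∘ʳ {p = p} p-inc (occurrence ι inc iso) =
  occurrence (ι ∘ p) (λ a b → inc (p a) (p b) ∘ p-inc a b) (orderIso-∘ p iso)

suc-increasing : ∀ {n} → Increasing (suc {n})
suc-increasing a b = s≤s

increasing-≢zero : ∀ {k n} {ι : Fin (suc k) → Fin (suc n)} →
  Increasing ι → ∀ a → ι (suc a) ≢ zero
increasing-≢zero {ι = ι} inc a ιa≡0 = ℕₚ.n≮0 (subst (ι zero <_) ιa≡0 (inc zero (suc a) ℕ.z<s))

occurs-unsuc : ∀ {n m k K} {f : Fin (suc n) → Fin m} {g : Fin k → Fin K} →
  (o : Occurs f g) → (∀ a → positions o a ≢ zero) → Occurs (f ∘ suc) g
occurs-unsuc {f = f} (occurrence ι inc iso) ≢0 =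
  occurrence ι′ inc′ (orderIso-trans (orderIso-≗ (cong f ∘ suc-ι′)) iso)
  where
  ι′ = λ a → punchOut (≢0 a ∘ sym)
  suc-ι′ : ∀ a → suc (ι′ a) ≡ ι a
  suc-ι′ a = Finₚ.punchIn-punchOut (≢0 a ∘ sym)
  inc′ : Increasing ι′
  inc′ a b a<b = ℕ.s<s⁻¹ (subst₂ _<_ (sym (suc-ι′ a)) (sym (suc-ι′ b)) (inc a b a<b))

infixr 5 _◂_ _◃_

_◂_ : ∀ {n} → Fin (suc n) → Perm n → Perm (suc n)
x ◂ ρ = x ∷ map (punchIn x) ρ

_◃_ : ∀ {n m} → Fin (suc m) → (Fin n → Fin m) → Fin (suc n) → Fin (suc m)
(x ◃ f) zero = x
(x ◃ f) (suc i) = punchIn x (f i)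

lookup-◂ : ∀ {n} (x : Fin (suc n)) (ρ : Perm n) i → lookup (x ◂ ρ) i ≡ (x ◃ lookup ρ) i
lookup-◂ x ρ zero = refl
lookup-◂ x ρ (suc i) = Vecₚ.lookup-map i (punchIn x) ρ

◂-orderIso : ∀ {n} (x : Fin (suc n)) (ρ : Perm n) → OrderIso (lookup (x ◂ ρ)) (x ◃ lookup ρ)
◂-orderIso x ρ = orderIso-≗ (lookup-◂ x ρ)

punchIn-mono-< : ∀ {n} (x : Fin (suc n)) {u v : Fin n} → u < v → punchIn x u < punchIn x v
punchIn-mono-< x {u} {v} u<v = ℕₚ.≰⇒> (ℕₚ.<⇒≱ u<v ∘ Finₚ.punchIn-cancel-≤ x v u)

punchIn-cancel-< : ∀ {n} (x : Fin (suc n)) {u v : Fin n} → punchIn x u < punchIn x v → u < v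
punchIn-cancel-< x {u} {v} p = ℕₚ.≰⇒> (ℕₚ.<⇒≱ p ∘ Finₚ.punchIn-mono-≤ x v u)

punchIn-orderIso : ∀ {n k} (x : Fin (suc n)) (f : Fin k → Fin n) → OrderIso f (punchIn x ∘ f)
punchIn-orderIso x = orderIso-embed (punchIn-mono-< x) (punchIn-cancel-< x)

occurs-◃ : ∀ {n m k K} {x : Fin (suc m)} {f : Fin n → Fin m} {g : Fin k → Fin K} →
  Occurs f g → Occurs (x ◃ f) g
occurs-◃ {x = x} {f} = occurs-∘ˡ suc-increasing ∘ occurs-resp (punchIn-orderIso x f) orderIso-refl

occurs-◃⁻ : ∀ {n m k K} {x : Fin (suc m)} {f : Fin n → Fin m} {g : Fin (suc k) → Fin K} →
  (o : Occurs (x ◃ f) g) → positions o zero ≢ zero → Occurs f g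
occurs-◃⁻ {x = x} {f} o ι₀≢0 =
  occurs-resp (orderIso-sym (punchIn-orderIso x f)) orderIso-refl (occurs-unsuc o ≢0)
  where
  ≢0 : ∀ a → positions o a ≢ zero
  ≢0 zero = ι₀≢0
  ≢0 (suc a) = increasing-≢zero (increasing o) a

-- An occurrence in x ◃ f of all pattern entries but the first never uses position 0.
occurs-◃-behead : ∀ {n m k K} {x : Fin (suc m)} {f : Fin n → Fin m} {g : Fin (suc k) → Fin K} →
  Occurs (x ◃ f) g → Occurs f (g ∘ suc)
occurs-◃-behead {x = x} {f} o =
  occurs-resp (orderIso-sym (punchIn-orderIso x f)) orderIso-refl
    (occurs-unsuc (occurs-∘ʳ suc-increasing o) (increasing-≢zero (increasing o)))

fromℕ-maximal : ∀ {m} (u : Fin (suc m)) → ¬ (fromℕ m < u)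
fromℕ-maximal u p = ℕₚ.<⇒≱ p (Finₚ.≤fromℕ u)

punchIn-fromℕ< : ∀ {m} (u : Fin m) → punchIn (fromℕ m) u < fromℕ m
punchIn-fromℕ< {suc m} zero = ℕ.z<s
punchIn-fromℕ< {suc m} (suc u) = ℕ.s<s (punchIn-fromℕ< u)

fromℕ◃-orderIso : ∀ {k m K} {f : Fin k → Fin m} {g : Fin k → Fin K} →
  OrderIso f g → OrderIso (fromℕ m ◃ f) (fromℕ K ◃ g)
fromℕ◃-orderIso {m = m} {K} {f} {g} iso = record { to-< = λ {a b} → to {a} {b} ; from-< = λ {a b} → from {a} {b} }
  where
  to : ∀ {a b} → (fromℕ m ◃ f) a < (fromℕ m ◃ f) b → (fromℕ K ◃ g) a < (fromℕ K ◃ g) b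
  to {zero} {zero} p = ⊥-elim (ℕₚ.<-irrefl refl p)
  to {zero} {suc b} p = ⊥-elim (fromℕ-maximal _ p)
  to {suc a} {zero} _ = punchIn-fromℕ< (g a)
  to {suc a} {suc b} p = punchIn-mono-< (fromℕ K) (to-< iso (punchIn-cancel-< (fromℕ m) p))
  from : ∀ {a b} → (fromℕ K ◃ g) a < (fromℕ K ◃ g) b → (fromℕ m ◃ f) a < (fromℕ m ◃ f) b
  from {zero} {zero} p = ⊥-elim (ℕₚ.<-irrefl refl p)
  from {zero} {suc b} p = ⊥-elim (fromℕ-maximal _ p)
  from {suc a} {zero} _ = punchIn-fromℕ< (f a)
  from {suc a} {suc b} p = punchIn-mono-< (fromℕ m) (from-< iso (punchIn-cancel-< (fromℕ K) p))

occurs-fromℕ◃ : ∀ {n m k K} {f : Fin n → Fin m} {g : Fin k → Fin K} →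
  Occurs f g → Occurs (fromℕ m ◃ f) (fromℕ K ◃ g)
occurs-fromℕ◃ {f = f} (occurrence ι inc iso) =
  occurrence ι′ inc′ (orderIso-trans (orderIso-≗ ◃-ι′) (fromℕ◃-orderIso iso))
  where
  ι′ : Fin (suc _) → Fin (suc _)
  ι′ zero = zero
  ι′ (suc a) = suc (ι a)
  inc′ : Increasing ι′
  inc′ zero (suc b) _ = ℕ.z<s
  inc′ (suc a) (suc b) a<b = ℕ.s<s (inc a b (ℕ.s<s⁻¹ a<b))
  ◃-ι′ : ∀ a → (fromℕ _ ◃ f) (ι′ a) ≡ (fromℕ _ ◃ (f ∘ ι)) a
  ◃-ι′ zero = refl
  ◃-ι′ (suc a) = refl

occurs-fromℕ◃⁻ : ∀ {n m k K} {f : Fin n → Fin m} {g : Fin (suc k) → Fin K} →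
  Occurs (fromℕ m ◃ f) g → (∃ λ a → g zero < g a) → Occurs f g
occurs-fromℕ◃⁻ {f = f} o (a , g₀<gₐ) with positions o zero Fin.≟ zero
... | no ι₀≢0 = occurs-◃⁻ o ι₀≢0
... | yes ι₀≡0 = ⊥-elim (fromℕ-maximal _
        (subst (λ i → (fromℕ _ ◃ f) i < (fromℕ _ ◃ f) (positions o a)) ι₀≡0 (from-< (orderIso o) g₀<gₐ)))

occurs-fromℕ◃-fromℕ◃⁻ : ∀ {n m k K} {f : Fin n → Fin m} {g : Fin k → Fin K} →
  Occurs (fromℕ m ◃ f) (fromℕ K ◃ g) → Occurs f (fromℕ K ◃ g) ⊎ Occurs f g
occurs-fromℕ◃-fromℕ◃⁻ {g = g} o with positions o zero Fin.≟ zero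
... | no ι₀≢0 = inj₁ (occurs-◃⁻ o ι₀≢0)
... | yes _ = inj₂ (occurs-resp orderIso-refl (orderIso-sym (punchIn-orderIso _ g)) (occurs-◃-behead o))

lookup-ext : ∀ {A : Set} {n} {u v : Vec A n} → (∀ i → lookup u i ≡ lookup v i) → u ≡ v
lookup-ext {u = u} {v} eq =
  trans (sym (Vecₚ.tabulate∘lookup u)) (trans (Vecₚ.tabulate-cong eq) (Vecₚ.tabulate∘lookup v))

◂-isPerm : ∀ {n} (x : Fin (suc n)) (ρ : Perm n) → IsPerm ρ → IsPerm (x ◂ ρ)
◂-isPerm x ρ ρ-inj {i} {j} eq = go i j (trans (sym (lookup-◂ x ρ i)) (trans eq (lookup-◂ x ρ j)))
  where
  go : ∀ i j → (x ◃ lookup ρ) i ≡ (x ◃ lookup ρ) j → i ≡ j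
  go zero zero _ = refl
  go zero (suc j) e = ⊥-elim (Finₚ.punchInᵢ≢i x (lookup ρ j) (sym e))
  go (suc i) zero e = ⊥-elim (Finₚ.punchInᵢ≢i x (lookup ρ i) e)
  go (suc i) (suc j) e = cong suc (ρ-inj (Finₚ.punchIn-injective x _ _ e))

◂-injective : ∀ {n} {x y : Fin (suc n)} {ρ σ : Perm n} → x ◂ ρ ≡ y ◂ σ → x ≡ y × ρ ≡ σ
◂-injective {x = x} {ρ = ρ} {σ} e with Vecₚ.∷-injective e
... | refl , e′ = refl , lookup-ext λ i → Finₚ.punchIn-injective x _ _
  (trans (sym (Vecₚ.lookup-map i (punchIn x) ρ))
    (trans (cong (λ v → lookup v i) e′) (Vecₚ.lookup-map i (punchIn x) σ)))

lookup-surjective : ∀ {n} (ρ : Perm n) → IsPerm ρ → ∀ v → ∃ λ i → lookup ρ i ≡ v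
lookup-surjective {zero} _ _ ()
lookup-surjective {suc n} ρ inj v with Finₚ.any? (λ i → lookup ρ i Fin.≟ v)
... | yes found = found
... | no missing = ⊥-elim (ℕₚ.<-irrefl refl (Finₚ.injective⇒≤ {f = squeeze} squeeze-injective))
  where
  v≢ : ∀ i → v ≢ lookup ρ i
  v≢ i v≡ρi = missing (i , sym v≡ρi)
  squeeze : Fin (suc n) → Fin n
  squeeze i = punchOut (v≢ i)
  squeeze-injective : Injective _≡_ _≡_ squeeze
  squeeze-injective {i} {j} = inj ∘ Finₚ.punchOut-injective (v≢ i) (v≢ j)

◂-decompose : ∀ {n} (π : Perm (suc n)) → IsPerm π → ∃ λ x → ∃ λ ρ → IsPerm ρ × π ≡ x ◂ ρ
◂-decompose (x ∷ τ) π-inj = x , ρ , ρ-inj , lookup-ext (λ i → sym (lookup-ρ i))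
  where
  x≢ : ∀ i → x ≢ lookup τ i
  x≢ i e with π-inj {zero} {suc i} e
  ... | ()
  ρ : Perm _
  ρ = tabulate (λ i → punchOut (x≢ i))
  lookup-ρ′ : ∀ i → lookup ρ i ≡ punchOut (x≢ i)
  lookup-ρ′ = Vecₚ.lookup∘tabulate _
  ρ-inj : IsPerm ρ
  ρ-inj {i} {j} e = Finₚ.suc-injective (π-inj {suc i} {suc j} (Finₚ.punchOut-injective (x≢ i) (x≢ j)
    (trans (sym (lookup-ρ′ i)) (trans e (lookup-ρ′ j)))))
  lookup-ρ : ∀ i → lookup (x ◂ ρ) i ≡ lookup (x ∷ τ) i
  lookup-ρ zero = refl
  lookup-ρ (suc i) = trans (lookup-◂ x ρ (suc i))
    (trans (cong (punchIn x) (lookup-ρ′ i)) (Finₚ.punchIn-punchOut (x≢ i)))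

-- Contains π σ as a record, so that π and σ can be inferred by unification.
infix 4 _≼_ _⋠_

record _≼_ {k n} (σ : Perm k) (π : Perm n) : Set where
  constructor ⟨_⟩
  field occurs : Occurs (lookup π) (lookup σ)

_⋠_ : ∀ {k n} → Perm k → Perm n → Set
σ ⋠ π = ¬ σ ≼ π

contains⇒≼ : ∀ {n k} {π : Perm n} {σ : Perm k} → Contains π σ → σ ≼ π
contains⇒≼ (ι , inc , iso) = ⟨ occurrence ι inc record
  { to-< = λ {a b} → proj₁ (iso a b) ; from-< = λ {a b} → proj₂ (iso a b) } ⟩

≼⇒contains : ∀ {n k} {π : Perm n} {σ : Perm k} → σ ≼ π → Contains π σ
≼⇒contains ⟨ occurrence ι inc iso ⟩ = ι , inc , λ a b → to-< iso , from-< iso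

≼-trans : ∀ {j k n} {τ : Perm j} {σ : Perm k} {π : Perm n} → τ ≼ σ → σ ≼ π → τ ≼ π
≼-trans ⟨ o ⟩ ⟨ o′ ⟩ = ⟨ occurs-trans o′ o ⟩

⋠-≼ : ∀ {j k n} {τ : Perm j} {σ : Perm k} {π : Perm n} → τ ≼ σ → τ ⋠ π → σ ⋠ π
⋠-≼ τ≼σ τ⋠π σ≼π = τ⋠π (≼-trans τ≼σ σ≼π)

≼-◂ : ∀ {n k} {x : Fin (suc n)} {ρ : Perm n} {σ : Perm k} → σ ≼ ρ → σ ≼ x ◂ ρ
≼-◂ {x = x} {ρ} ⟨ o ⟩ = ⟨ occurs-resp (orderIso-sym (◂-orderIso x ρ)) orderIso-refl (occurs-◃ o) ⟩

⋠-◂⁻ : ∀ {n k} {x : Fin (suc n)} {ρ : Perm n} {σ : Perm k} → σ ⋠ x ◂ ρ → σ ⋠ ρ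
⋠-◂⁻ σ⋠ = σ⋠ ∘ ≼-◂

≼-refl : ∀ {n} {π : Perm n} → π ≼ π
≼-refl = ⟨ occurs-refl ⟩

◂-≼-◂⁻ : ∀ {n k} {x : Fin (suc n)} {s : Fin (suc k)} {ρ : Perm n} {σ : Perm k} → s ◂ σ ≼ x ◂ ρ → σ ≼ ρ
◂-≼-◂⁻ {x = x} {s} {ρ} {σ} ⟨ o ⟩ = ⟨ occurs-resp orderIso-refl (orderIso-sym (punchIn-orderIso s (lookup σ)))
  (occurs-◃-behead (occurs-resp (◂-orderIso x ρ) (◂-orderIso s σ) o)) ⟩

⋠-singleton : ∀ {k} (σ : Perm (suc (suc k))) → σ ⋠ zero ∷ []
⋠-singleton σ ⟨ occurrence ι inc _ ⟩ with ι zero | ι (suc zero) | inc zero (suc zero) ℕ.z<s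
... | zero | zero | ()

◂-⋠-◂ : ∀ {n k} {x : Fin (suc n)} {s : Fin (suc k)} {ρ : Perm n} {σ : Perm k} → σ ⋠ ρ → s ◂ σ ⋠ x ◂ ρ
◂-⋠-◂ σ⋠ρ = σ⋠ρ ∘ ◂-≼-◂⁻

singleton-≼ : ∀ {n} (π : Perm (suc n)) → zero ∷ [] ≼ π
singleton-≼ π = ⟨ occurrence (λ _ → zero) (λ { zero zero () }) record
  { to-< = λ { {zero} {zero} p → ⊥-elim (ℕₚ.<-irrefl refl p) } ; from-< = λ { {zero} {zero} () } } ⟩

maxFirst : ∀ {n} → Perm n → Perm (suc n)
maxFirst {n} ρ = fromℕ n ◂ ρ

StartsBelowMax : ∀ {k} → Perm (suc k) → Set
StartsBelowMax σ = ∃ λ a → lookup σ zero < lookup σ a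

≼-maxFirst⁻ : ∀ {n k} {ρ : Perm n} {σ : Perm (suc k)} → StartsBelowMax σ → σ ≼ maxFirst ρ → σ ≼ ρ
≼-maxFirst⁻ {ρ = ρ} s ⟨ o ⟩ = ⟨ occurs-fromℕ◃⁻ (occurs-resp (◂-orderIso _ ρ) orderIso-refl o) s ⟩

maxFirst-≼-maxFirst : ∀ {n k} {ρ : Perm n} {σ : Perm k} → σ ≼ ρ → maxFirst σ ≼ maxFirst ρ
maxFirst-≼-maxFirst {ρ = ρ} {σ} ⟨ o ⟩ =
  ⟨ occurs-resp (orderIso-sym (◂-orderIso _ ρ)) (orderIso-sym (◂-orderIso _ σ)) (occurs-fromℕ◃ o) ⟩

maxFirst-≼-maxFirst⁻ : ∀ {n k} {ρ : Perm n} {σ : Perm k} →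
  maxFirst σ ≼ maxFirst ρ → maxFirst σ ≼ ρ ⊎ σ ≼ ρ
maxFirst-≼-maxFirst⁻ {ρ = ρ} {σ} ⟨ o ⟩
  with occurs-fromℕ◃-fromℕ◃⁻ (occurs-resp (◂-orderIso _ ρ) (◂-orderIso _ σ) o)
... | inj₁ o′ = inj₁ ⟨ occurs-resp orderIso-refl (orderIso-sym (◂-orderIso _ σ)) o′ ⟩
... | inj₂ o′ = inj₂ ⟨ o′ ⟩

maxFirst-⋠ : ∀ {n k} {ρ : Perm n} {σ : Perm (suc k)} → StartsBelowMax σ → σ ⋠ ρ → σ ⋠ maxFirst ρ
maxFirst-⋠ s σ⋠ρ = σ⋠ρ ∘ ≼-maxFirst⁻ s

maxFirst-⋠-maxFirst : ∀ {n k} {ρ : Perm n} {σ : Perm k} →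
  maxFirst σ ⋠ ρ → σ ⋠ ρ → maxFirst σ ⋠ maxFirst ρ
maxFirst-⋠-maxFirst ⋠₁ ⋠₂ c with maxFirst-≼-maxFirst⁻ c
... | inj₁ c₁ = ⋠₁ c₁
... | inj₂ c₂ = ⋠₂ c₂

maxFirst-⋠-maxFirst⁻ : ∀ {n k} {ρ : Perm n} {σ : Perm k} → maxFirst σ ⋠ maxFirst ρ → σ ⋠ ρ
maxFirst-⋠-maxFirst⁻ ⋠ = ⋠ ∘ maxFirst-≼-maxFirst

reverse : ∀ {A : Set} {n} → Vec A n → Vec A n
reverse v = tabulate (lookup v ∘ opposite)

complement : ∀ {m n} → Vec (Fin m) n → Vec (Fin m) n
complement = map opposite

lookup-reverse : ∀ {A : Set} {n} (v : Vec A n) i → lookup (reverse v) i ≡ lookup v (opposite i)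
lookup-reverse v = Vecₚ.lookup∘tabulate (lookup v ∘ opposite)

lookup-complement : ∀ {m n} (v : Vec (Fin m) n) i → lookup (complement v) i ≡ opposite (lookup v i)
lookup-complement v i = Vecₚ.lookup-map i opposite v

reverse-involutive : ∀ {A : Set} {n} (v : Vec A n) → reverse (reverse v) ≡ v
reverse-involutive v = lookup-ext λ i → trans (lookup-reverse (reverse v) i)
  (trans (lookup-reverse v (opposite i)) (cong (lookup v) (Finₚ.opposite-involutive i)))

complement-involutive : ∀ {m n} (v : Vec (Fin m) n) → complement (complement v) ≡ v
complement-involutive v = lookup-ext λ i → trans (lookup-complement (complement v) i)
  (trans (cong opposite (lookup-complement v i)) (Finₚ.opposite-involutive (lookup v i)))

opposite-< : ∀ {n} {i j : Fin n} → i < j → opposite j < opposite i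
opposite-< {n} {i} {j} i<j rewrite Finₚ.opposite-prop i | Finₚ.opposite-prop j =
  ℕₚ.∸-monoʳ-< (ℕ.s<s i<j) (Finₚ.toℕ<n j)

opposite-<⁻ : ∀ {n} {i j : Fin n} → opposite j < opposite i → i < j
opposite-<⁻ {n} {i} {j} p rewrite Finₚ.opposite-prop i | Finₚ.opposite-prop j =
  ℕ.s<s⁻¹ (ℕₚ.∸-cancelʳ-< {suc (toℕ j)} {suc (toℕ i)} {n} p)

opposite-injective : ∀ {n} → Injective _≡_ _≡_ (opposite {n})
opposite-injective {n} {i} {j} e =
  trans (sym (Finₚ.opposite-involutive i)) (trans (cong opposite e) (Finₚ.opposite-involutive j))

orderIso-opposite : ∀ {k m K} {f : Fin k → Fin m} {g : Fin k → Fin K} →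
  OrderIso f g → OrderIso (opposite ∘ f) (opposite ∘ g)
orderIso-opposite iso = record
  { to-< = opposite-< ∘ to-< iso ∘ opposite-<⁻ ; from-< = opposite-< ∘ from-< iso ∘ opposite-<⁻ }

occurs-reverse : ∀ {n m k K} {f : Fin n → Fin m} {g : Fin k → Fin K} →
  Occurs f g → Occurs (f ∘ opposite) (g ∘ opposite)
occurs-reverse {f = f} (occurrence ι inc iso) = occurrence (opposite ∘ ι ∘ opposite)
  (λ a b → opposite-< ∘ inc (opposite b) (opposite a) ∘ opposite-<)
  (orderIso-trans (orderIso-≗ λ a → cong f (Finₚ.opposite-involutive (ι (opposite a)))) (orderIso-∘ opposite iso))

occurs-complement : ∀ {n m k K} {f : Fin n → Fin m} {g : Fin k → Fin K} →
  Occurs f g → Occurs (opposite ∘ f) (opposite ∘ g)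
occurs-complement (occurrence ι inc iso) = occurrence ι inc (orderIso-opposite iso)

reverse-≼ : ∀ {n k} {π : Perm n} {σ : Perm k} → σ ≼ π → reverse σ ≼ reverse π
reverse-≼ {π = π} {σ} ⟨ o ⟩ =
  ⟨ occurs-resp (orderIso-≗ (sym ∘ lookup-reverse π)) (orderIso-≗ (sym ∘ lookup-reverse σ)) (occurs-reverse o) ⟩

complement-≼ : ∀ {n k} {π : Perm n} {σ : Perm k} → σ ≼ π → complement σ ≼ complement π
complement-≼ {π = π} {σ} ⟨ o ⟩ =
  ⟨ occurs-resp (orderIso-≗ (sym ∘ lookup-complement π)) (orderIso-≗ (sym ∘ lookup-complement σ))
      (occurs-complement o) ⟩

reverse-isPerm : ∀ {n} (π : Perm n) → IsPerm π → IsPerm (reverse π)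
reverse-isPerm π inj {i} {j} e =
  opposite-injective (inj (trans (sym (lookup-reverse π i)) (trans e (lookup-reverse π j))))

complement-isPerm : ∀ {n} (π : Perm n) → IsPerm π → IsPerm (complement π)
complement-isPerm π inj {i} {j} e =
  inj (opposite-injective (trans (sym (lookup-complement π i)) (trans e (lookup-complement π j))))

reverse-≼ˡ : ∀ {n k} {π : Perm n} {σ : Perm k} → reverse σ ≼ π → σ ≼ reverse π
reverse-≼ˡ {σ = σ} = subst (_≼ _) (reverse-involutive σ) ∘ reverse-≼

reverse-≼ʳ : ∀ {n k} {π : Perm n} {σ : Perm k} → σ ≼ reverse π → reverse σ ≼ π
reverse-≼ʳ {π = π} = subst (_ ≼_) (reverse-involutive π) ∘ reverse-≼

reverse-≼⁻ : ∀ {n k} {π : Perm n} {σ : Perm k} → reverse σ ≼ reverse π → σ ≼ π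
reverse-≼⁻ {π = π} = subst (_ ≼_) (reverse-involutive π) ∘ reverse-≼ˡ

maxLast : ∀ {n} → Perm n → Perm (suc n)
maxLast ρ = reverse (maxFirst (reverse ρ))

EndsBelowMax : ∀ {k} → Perm (suc k) → Set
EndsBelowMax σ = StartsBelowMax (reverse σ)

≼-maxLast⁻ : ∀ {n k} {ρ : Perm n} {σ : Perm (suc k)} → EndsBelowMax σ → σ ≼ maxLast ρ → σ ≼ ρ
≼-maxLast⁻ s = reverse-≼⁻ ∘ ≼-maxFirst⁻ s ∘ reverse-≼ʳ

≼-maxLast : ∀ {n k} {ρ : Perm n} {σ : Perm k} → σ ≼ ρ → σ ≼ maxLast ρ
≼-maxLast = reverse-≼ˡ ∘ ≼-◂ ∘ reverse-≼

maxLast-≼-maxLast : ∀ {n k} {ρ : Perm n} {σ : Perm k} → σ ≼ ρ → maxLast σ ≼ maxLast ρ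
maxLast-≼-maxLast = reverse-≼ ∘ maxFirst-≼-maxFirst ∘ reverse-≼

maxLast-≼-maxLast⁻ : ∀ {n k} {ρ : Perm n} {σ : Perm k} →
  maxLast σ ≼ maxLast ρ → maxLast σ ≼ ρ ⊎ σ ≼ ρ
maxLast-≼-maxLast⁻ c with maxFirst-≼-maxFirst⁻ (reverse-≼⁻ c)
... | inj₁ c₁ = inj₁ (reverse-≼ʳ c₁)
... | inj₂ c₂ = inj₂ (reverse-≼⁻ c₂)

maxLast-⋠ : ∀ {n k} {ρ : Perm n} {σ : Perm (suc k)} → EndsBelowMax σ → σ ⋠ ρ → σ ⋠ maxLast ρ
maxLast-⋠ s σ⋠ρ = σ⋠ρ ∘ ≼-maxLast⁻ s

maxLast-⋠-maxLast : ∀ {n k} {ρ : Perm n} {σ : Perm k} →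
  maxLast σ ⋠ ρ → σ ⋠ ρ → maxLast σ ⋠ maxLast ρ
maxLast-⋠-maxLast ⋠₁ ⋠₂ c with maxLast-≼-maxLast⁻ c
... | inj₁ c₁ = ⋠₁ c₁
... | inj₂ c₂ = ⋠₂ c₂

maxLast-⋠-maxLast⁻ : ∀ {n k} {ρ : Perm n} {σ : Perm k} → maxLast σ ⋠ maxLast ρ → σ ⋠ ρ
maxLast-⋠-maxLast⁻ ⋠ = ⋠ ∘ maxLast-≼-maxLast

⋠-maxLast⁻ : ∀ {n k} {ρ : Perm n} {σ : Perm k} → σ ⋠ maxLast ρ → σ ⋠ ρ
⋠-maxLast⁻ ⋠ = ⋠ ∘ ≼-maxLast

-- Phrased with _<ᵇ_ so that for a concrete pattern it computes to a single inequality.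
SameOrder : ∀ {k m} → Fin k → Fin k → Fin m → Fin m → Set
SameOrder s t u v = if toℕ s <ᵇ toℕ t then u < v else v < u

-- In x ◂ ρ, the head x and the entry coming from the entry u of ρ are in the order of s and t.
HeadOrder : ∀ {k m} → Fin k → Fin k → Fin (suc m) → Fin m → Set
HeadOrder s t x u = if toℕ s <ᵇ toℕ t then x Fin.≤ u else u < x

if-map : ∀ b {A A′ B B′ : Set} → (A → A′) → (B → B′) → (if b then A else B) → if b then A′ else B′
if-map true f g = f
if-map false f g = g

if-view : ∀ b {A B : Set} → (if b then A else B) → (T b × A) ⊎ (¬ T b × B)
if-view true a = inj₁ (tt , a)
if-view false b = inj₂ ((λ ()) , b)

if-intro : ∀ b {A B : Set} → (T b → A) → (¬ T b → B) → if b then A else B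
if-intro true f g = f tt
if-intro false f g = g (λ ())

sameOrder-view : ∀ {k m} {s t : Fin k} {u v : Fin m} → SameOrder s t u v → (s < t × u < v) ⊎ (¬ s < t × v < u)
sameOrder-view {s = s} {t} o with if-view (toℕ s <ᵇ toℕ t) o
... | inj₁ (s<ᵇt , u<v) = inj₁ (ℕₚ.<ᵇ⇒< _ _ s<ᵇt , u<v)
... | inj₂ (s≮ᵇt , v<u) = inj₂ (s≮ᵇt ∘ ℕₚ.<⇒<ᵇ , v<u)

orderIso⇒sameOrder : ∀ {k m K} {f : Fin k → Fin m} {g : Fin k → Fin K} →
  OrderIso f g → ∀ a b → g a ≢ g b → SameOrder (g a) (g b) (f a) (f b)
orderIso⇒sameOrder iso a b ga≢gb = if-intro _ (from-< iso ∘ ℕₚ.<ᵇ⇒< _ _)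
  λ ga≮ᵇgb → from-< iso (ℕₚ.≤∧≢⇒< (ℕₚ.≮⇒≥ (ga≮ᵇgb ∘ ℕₚ.<⇒<ᵇ)) (ga≢gb ∘ sym ∘ Finₚ.toℕ-injective))

sameOrder⇒orderIso : ∀ {k m K} {f : Fin k → Fin m} {g : Fin k → Fin K} → (∀ {a b} → g a ≡ g b → a ≡ b) →
  (∀ a b → a < b → SameOrder (g a) (g b) (f a) (f b)) → OrderIso f g
sameOrder⇒orderIso {f = f} {g} g-inj pairs = record { to-< = λ {a b} → to a b ; from-< = λ {a b} → from a b }
  where
  ≮⇒> : ∀ {a b} → a ≢ b → ¬ g a < g b → g b < g a
  ≮⇒> a≢b ga≮gb = ℕₚ.≤∧≢⇒< (ℕₚ.≮⇒≥ ga≮gb) (a≢b ∘ sym ∘ g-inj ∘ Finₚ.toℕ-injective)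
  to : ∀ a b → f a < f b → g a < g b
  to a b fa<fb with Finₚ.<-cmp a b
  ... | tri< a<b _ _ with sameOrder-view (pairs a b a<b)
  ...   | inj₁ (ga<gb , _) = ga<gb
  ...   | inj₂ (_ , fb<fa) = ⊥-elim (ℕₚ.<-asym fa<fb fb<fa)
  to a b fa<fb | tri≈ _ refl _ = ⊥-elim (ℕₚ.<-irrefl refl fa<fb)
  to a b fa<fb | tri> _ b≢a b<a with sameOrder-view (pairs b a b<a)
  ...   | inj₁ (_ , fb<fa) = ⊥-elim (ℕₚ.<-asym fa<fb fb<fa)
  ...   | inj₂ (gb≮ga , _) = ≮⇒> (b≢a ∘ sym) gb≮ga
  from : ∀ a b → g a < g b → f a < f b
  from a b ga<gb with Finₚ.<-cmp a b
  ... | tri< a<b _ _ with sameOrder-view (pairs a b a<b)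
  ...   | inj₁ (_ , fa<fb) = fa<fb
  ...   | inj₂ (ga≮gb , _) = ⊥-elim (ga≮gb ga<gb)
  from a b ga<gb | tri≈ _ refl _ = ⊥-elim (ℕₚ.<-irrefl refl ga<gb)
  from a b ga<gb | tri> _ _ b<a with sameOrder-view (pairs b a b<a)
  ...   | inj₁ (gb<ga , _) = ⊥-elim (ℕₚ.<-asym ga<gb gb<ga)
  ...   | inj₂ (_ , fa<fb) = fa<fb

punchIn-below : ∀ {n} (x : Fin (suc n)) (u : Fin n) → u < x → toℕ (punchIn x u) ≡ toℕ u
punchIn-below (suc x) zero _ = refl
punchIn-below (suc x) (suc u) u<x = cong suc (punchIn-below x u (ℕ.s<s⁻¹ u<x))

punchIn-above : ∀ {n} (x : Fin (suc n)) (u : Fin n) → x Fin.≤ u → toℕ (punchIn x u) ≡ suc (toℕ u)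
punchIn-above zero u _ = refl
punchIn-above (suc x) (suc u) x≤u = cong suc (punchIn-above x u (ℕₚ.≤-pred x≤u))

headOrder⇒sameOrder : ∀ {k m} (s t : Fin k) (x : Fin (suc m)) {u : Fin m} →
  HeadOrder s t x u → SameOrder s t x (punchIn x u)
headOrder⇒sameOrder s t x {u} = if-map (toℕ s <ᵇ toℕ t)
  (λ x≤u → subst (toℕ x ℕ.<_) (sym (punchIn-above x u x≤u)) (s≤s x≤u))
  (λ u<x → subst (ℕ._< toℕ x) (sym (punchIn-below x u u<x)) u<x)

sameOrder⇒headOrder : ∀ {k m} (s t : Fin k) (x : Fin (suc m)) {u : Fin m} →
  SameOrder s t x (punchIn x u) → HeadOrder s t x u
sameOrder⇒headOrder s t x {u} = if-map (toℕ s <ᵇ toℕ t) above below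
  where
  above : x < punchIn x u → x Fin.≤ u
  above x<u′ with u Fin.<? x
  ... | yes u<x = ⊥-elim (ℕₚ.<-asym u<x (subst (toℕ x ℕ.<_) (punchIn-below x u u<x) x<u′))
  ... | no u≮x = ℕₚ.≮⇒≥ u≮x
  below : punchIn x u < x → u < x
  below u′<x with u Fin.<? x
  ... | yes u<x = u<x
  ... | no u≮x = ⊥-elim (ℕₚ.<-asym u′<x
          (subst (toℕ x ℕ.<_) (sym (punchIn-above x u (ℕₚ.≮⇒≥ u≮x))) (s≤s (ℕₚ.≮⇒≥ u≮x))))

sameOrder-punchIn : ∀ {k m} (s t : Fin k) (x : Fin (suc m)) {u v : Fin m} →
  SameOrder s t u v → SameOrder s t (punchIn x u) (punchIn x v)
sameOrder-punchIn s t x = if-map (toℕ s <ᵇ toℕ t) (punchIn-mono-< x) (punchIn-mono-< x)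

sameOrder-punchIn⁻ : ∀ {k m} (s t : Fin k) (x : Fin (suc m)) {u v : Fin m} →
  SameOrder s t (punchIn x u) (punchIn x v) → SameOrder s t u v
sameOrder-punchIn⁻ s t x = if-map (toℕ s <ᵇ toℕ t) (punchIn-cancel-< x) (punchIn-cancel-< x)

isPerm? : ∀ {k} (σ : Perm k) → Dec (∀ a b → lookup σ a ≡ lookup σ b → a ≡ b)
isPerm? σ = Finₚ.all? λ a → Finₚ.all? λ b → (lookup σ a Fin.≟ lookup σ b) →-dec (a Fin.≟ b)

decide-isPerm : ∀ {k} (σ : Perm k) → {True (isPerm? σ)} → IsPerm σ
decide-isPerm σ {t} = toWitness t _ _

module _ {n m K : ℕ} where

  Occurs₂ : (Fin n → Fin m) → (Fin 2 → Fin K) → Set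
  Occurs₂ f g = Σ (Fin n) λ i → Σ (Fin n) λ j → i < j × SameOrder (g (# 0)) (g (# 1)) (f i) (f j)

  Occurs₃ : (Fin n → Fin m) → (Fin 3 → Fin K) → Set
  Occurs₃ f g = Σ (Fin n) λ i → Σ (Fin n) λ j → Σ (Fin n) λ l → i < j × j < l ×
    SameOrder (g (# 0)) (g (# 1)) (f i) (f j) × SameOrder (g (# 0)) (g (# 2)) (f i) (f l) ×
    SameOrder (g (# 1)) (g (# 2)) (f j) (f l)

  Occurs₄ : (Fin n → Fin m) → (Fin 4 → Fin K) → Set
  Occurs₄ f g = Σ (Fin n) λ i → Σ (Fin n) λ j → Σ (Fin n) λ l → Σ (Fin n) λ p → i < j × j < l × l < p ×
    SameOrder (g (# 0)) (g (# 1)) (f i) (f j) × SameOrder (g (# 0)) (g (# 2)) (f i) (f l) ×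
    SameOrder (g (# 0)) (g (# 3)) (f i) (f p) × SameOrder (g (# 1)) (g (# 2)) (f j) (f l) ×
    SameOrder (g (# 1)) (g (# 3)) (f j) (f p) × SameOrder (g (# 2)) (g (# 3)) (f l) (f p)

  -- The occurrences of g in x ◃ f that use position 0, described in terms of f.

  HeadOccurs₂ : Fin (suc m) → (Fin n → Fin m) → (Fin 2 → Fin K) → Set
  HeadOccurs₂ x f g = Σ (Fin n) λ j → HeadOrder (g (# 0)) (g (# 1)) x (f j)

  HeadOccurs₃ : Fin (suc m) → (Fin n → Fin m) → (Fin 3 → Fin K) → Set
  HeadOccurs₃ x f g = Σ (Fin n) λ j → Σ (Fin n) λ l → j < l × SameOrder (g (# 1)) (g (# 2)) (f j) (f l) ×
    HeadOrder (g (# 0)) (g (# 1)) x (f j) × HeadOrder (g (# 0)) (g (# 2)) x (f l)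

  HeadOccurs₄ : Fin (suc m) → (Fin n → Fin m) → (Fin 4 → Fin K) → Set
  HeadOccurs₄ x f g = Σ (Fin n) λ j → Σ (Fin n) λ l → Σ (Fin n) λ p → j < l × l < p ×
    SameOrder (g (# 1)) (g (# 2)) (f j) (f l) × SameOrder (g (# 1)) (g (# 3)) (f j) (f p) ×
    SameOrder (g (# 2)) (g (# 3)) (f l) (f p) ×
    HeadOrder (g (# 0)) (g (# 1)) x (f j) × HeadOrder (g (# 0)) (g (# 2)) x (f l) ×
    HeadOrder (g (# 0)) (g (# 3)) x (f p)

module _ {n m K : ℕ} {f : Fin n → Fin m} where

  module _ {g : Fin 2 → Fin K} (g-inj : ∀ {a b} → g a ≡ g b → a ≡ b) where

    occurs⇒₂ : Occurs f g → Occurs₂ f g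
    occurs⇒₂ (occurrence ι inc iso) =
      ι (# 0) , ι (# 1) , inc (# 0) (# 1) ℕ.z<s , so (# 0) (# 1) λ ()
      where so = λ a b a≢b → orderIso⇒sameOrder iso a b (a≢b ∘ g-inj)

    ₂⇒occurs : Occurs₂ f g → Occurs f g
    ₂⇒occurs (i , j , i<j , o₀₁) = occurrence ι inc (sameOrder⇒orderIso g-inj pairs)
      where
      ι : Fin 2 → Fin n
      ι zero = i
      ι (suc zero) = j
      inc : Increasing ι
      inc zero (suc zero) _ = i<j
      inc _ zero ()
      inc (suc zero) (suc zero) (s≤s ())
      pairs : ∀ a b → a < b → SameOrder (g a) (g b) (f (ι a)) (f (ι b))
      pairs zero (suc zero) _ = o₀₁
      pairs _ zero ()
      pairs (suc zero) (suc zero) (s≤s ())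

  module _ {g : Fin 3 → Fin K} (g-inj : ∀ {a b} → g a ≡ g b → a ≡ b) where

    occurs⇒₃ : Occurs f g → Occurs₃ f g
    occurs⇒₃ (occurrence ι inc iso) =
      ι (# 0) , ι (# 1) , ι (# 2) , inc (# 0) (# 1) ℕ.z<s , inc (# 1) (# 2) (ℕ.s<s ℕ.z<s) ,
      so (# 0) (# 1) (λ ()) , so (# 0) (# 2) (λ ()) , so (# 1) (# 2) (λ ())
      where so = λ a b a≢b → orderIso⇒sameOrder iso a b (a≢b ∘ g-inj)

    ₃⇒occurs : Occurs₃ f g → Occurs f g
    ₃⇒occurs (i , j , l , i<j , j<l , o₀₁ , o₀₂ , o₁₂) = occurrence ι inc (sameOrder⇒orderIso g-inj pairs)
      where
      ι : Fin 3 → Fin n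
      ι zero = i
      ι (suc zero) = j
      ι (suc (suc zero)) = l
      inc : Increasing ι
      inc zero (suc zero) _ = i<j
      inc zero (suc (suc zero)) _ = ℕₚ.<-trans i<j j<l
      inc (suc zero) (suc (suc zero)) _ = j<l
      inc _ zero ()
      inc (suc _) (suc zero) (s≤s ())
      inc (suc (suc _)) (suc (suc zero)) (s≤s (s≤s ()))
      pairs : ∀ a b → a < b → SameOrder (g a) (g b) (f (ι a)) (f (ι b))
      pairs zero (suc zero) _ = o₀₁
      pairs zero (suc (suc zero)) _ = o₀₂
      pairs (suc zero) (suc (suc zero)) _ = o₁₂
      pairs _ zero ()
      pairs (suc _) (suc zero) (s≤s ())
      pairs (suc (suc _)) (suc (suc zero)) (s≤s (s≤s ()))

  module _ {g : Fin 4 → Fin K} (g-inj : ∀ {a b} → g a ≡ g b → a ≡ b) where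

    occurs⇒₄ : Occurs f g → Occurs₄ f g
    occurs⇒₄ (occurrence ι inc iso) =
      ι (# 0) , ι (# 1) , ι (# 2) , ι (# 3) ,
      inc (# 0) (# 1) ℕ.z<s , inc (# 1) (# 2) (ℕ.s<s ℕ.z<s) , inc (# 2) (# 3) (ℕ.s<s (ℕ.s<s ℕ.z<s)) ,
      so (# 0) (# 1) (λ ()) , so (# 0) (# 2) (λ ()) , so (# 0) (# 3) (λ ()) ,
      so (# 1) (# 2) (λ ()) , so (# 1) (# 3) (λ ()) , so (# 2) (# 3) (λ ())
      where so = λ a b a≢b → orderIso⇒sameOrder iso a b (a≢b ∘ g-inj)

    ₄⇒occurs : Occurs₄ f g → Occurs f g
    ₄⇒occurs (i , j , l , p , i<j , j<l , l<p , o₀₁ , o₀₂ , o₀₃ , o₁₂ , o₁₃ , o₂₃) =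
      occurrence ι inc (sameOrder⇒orderIso g-inj pairs)
      where
      ι : Fin 4 → Fin n
      ι zero = i
      ι (suc zero) = j
      ι (suc (suc zero)) = l
      ι (suc (suc (suc zero))) = p
      inc : Increasing ι
      inc zero (suc zero) _ = i<j
      inc zero (suc (suc zero)) _ = ℕₚ.<-trans i<j j<l
      inc zero (suc (suc (suc zero))) _ = ℕₚ.<-trans i<j (ℕₚ.<-trans j<l l<p)
      inc (suc zero) (suc (suc zero)) _ = j<l
      inc (suc zero) (suc (suc (suc zero))) _ = ℕₚ.<-trans j<l l<p
      inc (suc (suc zero)) (suc (suc (suc zero))) _ = l<p
      inc _ zero ()
      inc (suc _) (suc zero) (s≤s ())
      inc (suc (suc _)) (suc (suc zero)) (s≤s (s≤s ()))
      inc (suc (suc (suc _))) (suc (suc (suc zero))) (s≤s (s≤s (s≤s ())))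
      pairs : ∀ a b → a < b → SameOrder (g a) (g b) (f (ι a)) (f (ι b))
      pairs zero (suc zero) _ = o₀₁
      pairs zero (suc (suc zero)) _ = o₀₂
      pairs zero (suc (suc (suc zero))) _ = o₀₃
      pairs (suc zero) (suc (suc zero)) _ = o₁₂
      pairs (suc zero) (suc (suc (suc zero))) _ = o₁₃
      pairs (suc (suc zero)) (suc (suc (suc zero))) _ = o₂₃
      pairs _ zero ()
      pairs (suc _) (suc zero) (s≤s ())
      pairs (suc (suc _)) (suc (suc zero)) (s≤s (s≤s ()))
      pairs (suc (suc (suc _))) (suc (suc (suc zero))) (s≤s (s≤s (s≤s ())))

module _ {n m K : ℕ} (x : Fin (suc m)) {f : Fin n → Fin m} where

  module _ {g : Fin 2 → Fin K} where

    ◃-occurs₂ : Occurs₂ (x ◃ f) g → Occurs₂ f g ⊎ HeadOccurs₂ x f g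
    ◃-occurs₂ (zero , suc j , _ , o₀₁) = inj₂ (j , sameOrder⇒headOrder (g (# 0)) (g (# 1)) x o₀₁)
    ◃-occurs₂ (suc i , suc j , i<j , o₀₁) = inj₁ (i , j , ℕ.s<s⁻¹ i<j , sameOrder-punchIn⁻ (g (# 0)) (g (# 1)) x o₀₁)

    headOccurs⇒₂ : HeadOccurs₂ x f g → Occurs₂ (x ◃ f) g
    headOccurs⇒₂ (j , h₀₁) = zero , suc j , ℕ.z<s , headOrder⇒sameOrder (g (# 0)) (g (# 1)) x h₀₁

  module _ {g : Fin 3 → Fin K} where

    ◃-occurs₃ : Occurs₃ (x ◃ f) g → Occurs₃ f g ⊎ HeadOccurs₃ x f g
    ◃-occurs₃ (zero , suc j , suc l , _ , j<l , o₀₁ , o₀₂ , o₁₂) = inj₂ (j , l , ℕ.s<s⁻¹ j<l ,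
      sameOrder-punchIn⁻ (g (# 1)) (g (# 2)) x o₁₂ ,
      sameOrder⇒headOrder (g (# 0)) (g (# 1)) x o₀₁ , sameOrder⇒headOrder (g (# 0)) (g (# 2)) x o₀₂)
    ◃-occurs₃ (suc i , suc j , suc l , i<j , j<l , o₀₁ , o₀₂ , o₁₂) = inj₁ (i , j , l , ℕ.s<s⁻¹ i<j , ℕ.s<s⁻¹ j<l ,
      sameOrder-punchIn⁻ (g (# 0)) (g (# 1)) x o₀₁ , sameOrder-punchIn⁻ (g (# 0)) (g (# 2)) x o₀₂ ,
      sameOrder-punchIn⁻ (g (# 1)) (g (# 2)) x o₁₂)

    headOccurs⇒₃ : HeadOccurs₃ x f g → Occurs₃ (x ◃ f) g
    headOccurs⇒₃ (j , l , j<l , o₁₂ , h₀₁ , h₀₂) = zero , suc j , suc l , ℕ.z<s , ℕ.s<s j<l ,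
      headOrder⇒sameOrder (g (# 0)) (g (# 1)) x h₀₁ , headOrder⇒sameOrder (g (# 0)) (g (# 2)) x h₀₂ ,
      sameOrder-punchIn (g (# 1)) (g (# 2)) x o₁₂

  module _ {g : Fin 4 → Fin K} where

    ◃-occurs₄ : Occurs₄ (x ◃ f) g → Occurs₄ f g ⊎ HeadOccurs₄ x f g
    ◃-occurs₄ (zero , suc j , suc l , suc p , _ , j<l , l<p , o₀₁ , o₀₂ , o₀₃ , o₁₂ , o₁₃ , o₂₃) =
      inj₂ (j , l , p , ℕ.s<s⁻¹ j<l , ℕ.s<s⁻¹ l<p ,
        sameOrder-punchIn⁻ (g (# 1)) (g (# 2)) x o₁₂ , sameOrder-punchIn⁻ (g (# 1)) (g (# 3)) x o₁₃ ,
        sameOrder-punchIn⁻ (g (# 2)) (g (# 3)) x o₂₃ ,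
        sameOrder⇒headOrder (g (# 0)) (g (# 1)) x o₀₁ , sameOrder⇒headOrder (g (# 0)) (g (# 2)) x o₀₂ ,
        sameOrder⇒headOrder (g (# 0)) (g (# 3)) x o₀₃)
    ◃-occurs₄ (suc i , suc j , suc l , suc p , i<j , j<l , l<p , o₀₁ , o₀₂ , o₀₃ , o₁₂ , o₁₃ , o₂₃) =
      inj₁ (i , j , l , p , ℕ.s<s⁻¹ i<j , ℕ.s<s⁻¹ j<l , ℕ.s<s⁻¹ l<p ,
        sameOrder-punchIn⁻ (g (# 0)) (g (# 1)) x o₀₁ , sameOrder-punchIn⁻ (g (# 0)) (g (# 2)) x o₀₂ ,
        sameOrder-punchIn⁻ (g (# 0)) (g (# 3)) x o₀₃ , sameOrder-punchIn⁻ (g (# 1)) (g (# 2)) x o₁₂ ,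
        sameOrder-punchIn⁻ (g (# 1)) (g (# 3)) x o₁₃ , sameOrder-punchIn⁻ (g (# 2)) (g (# 3)) x o₂₃)

    headOccurs⇒₄ : HeadOccurs₄ x f g → Occurs₄ (x ◃ f) g
    headOccurs⇒₄ (j , l , p , j<l , l<p , o₁₂ , o₁₃ , o₂₃ , h₀₁ , h₀₂ , h₀₃) =
      zero , suc j , suc l , suc p , ℕ.z<s , ℕ.s<s j<l , ℕ.s<s l<p ,
      headOrder⇒sameOrder (g (# 0)) (g (# 1)) x h₀₁ , headOrder⇒sameOrder (g (# 0)) (g (# 2)) x h₀₂ ,
      headOrder⇒sameOrder (g (# 0)) (g (# 3)) x h₀₃ ,
      sameOrder-punchIn (g (# 1)) (g (# 2)) x o₁₂ , sameOrder-punchIn (g (# 1)) (g (# 3)) x o₁₃ ,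
      sameOrder-punchIn (g (# 2)) (g (# 3)) x o₂₃

module Pattern₂ (σ : Perm 2) (σ-isPerm : IsPerm σ) where

  intro : ∀ {n} {π : Perm n} → Occurs₂ (lookup π) (lookup σ) → σ ≼ π
  intro = ⟨_⟩ ∘ ₂⇒occurs σ-isPerm

  split : ∀ {n} (x : Fin (suc n)) (ρ : Perm n) → σ ≼ x ◂ ρ → σ ≼ ρ ⊎ HeadOccurs₂ x (lookup ρ) (lookup σ)
  split x ρ ⟨ o ⟩
    with ◃-occurs₂ x {lookup ρ} {lookup σ} (occurs⇒₂ σ-isPerm (occurs-resp (◂-orderIso x ρ) orderIso-refl o))
  ... | inj₁ t = inj₁ (intro t)
  ... | inj₂ h = inj₂ h

  head : ∀ {n} {x : Fin (suc n)} {ρ : Perm n} → HeadOccurs₂ x (lookup ρ) (lookup σ) → σ ≼ x ◂ ρ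
  head {x = x} {ρ} h = ⟨ occurs-resp (orderIso-sym (◂-orderIso x ρ)) orderIso-refl
    (₂⇒occurs σ-isPerm (headOccurs⇒₂ x {lookup ρ} {lookup σ} h)) ⟩

module Pattern₃ (σ : Perm 3) (σ-isPerm : IsPerm σ) where

  intro : ∀ {n} {π : Perm n} → Occurs₃ (lookup π) (lookup σ) → σ ≼ π
  intro = ⟨_⟩ ∘ ₃⇒occurs σ-isPerm

  elim : ∀ {n} {π : Perm n} → σ ≼ π → Occurs₃ (lookup π) (lookup σ)
  elim ⟨ o ⟩ = occurs⇒₃ σ-isPerm o

  split : ∀ {n} (x : Fin (suc n)) (ρ : Perm n) → σ ≼ x ◂ ρ → σ ≼ ρ ⊎ HeadOccurs₃ x (lookup ρ) (lookup σ)
  split x ρ ⟨ o ⟩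
    with ◃-occurs₃ x {lookup ρ} {lookup σ} (occurs⇒₃ σ-isPerm (occurs-resp (◂-orderIso x ρ) orderIso-refl o))
  ... | inj₁ t = inj₁ (intro t)
  ... | inj₂ h = inj₂ h

  head : ∀ {n} {x : Fin (suc n)} {ρ : Perm n} → HeadOccurs₃ x (lookup ρ) (lookup σ) → σ ≼ x ◂ ρ
  head {x = x} {ρ} h = ⟨ occurs-resp (orderIso-sym (◂-orderIso x ρ)) orderIso-refl
    (₃⇒occurs σ-isPerm (headOccurs⇒₃ x {lookup ρ} {lookup σ} h)) ⟩

module Pattern₄ (σ : Perm 4) (σ-isPerm : IsPerm σ) where

  intro : ∀ {n} {π : Perm n} → Occurs₄ (lookup π) (lookup σ) → σ ≼ π
  intro = ⟨_⟩ ∘ ₄⇒occurs σ-isPerm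

  split : ∀ {n} (x : Fin (suc n)) (ρ : Perm n) → σ ≼ x ◂ ρ → σ ≼ ρ ⊎ HeadOccurs₄ x (lookup ρ) (lookup σ)
  split x ρ ⟨ o ⟩
    with ◃-occurs₄ x {lookup ρ} {lookup σ} (occurs⇒₄ σ-isPerm (occurs-resp (◂-orderIso x ρ) orderIso-refl o))
  ... | inj₁ t = inj₁ (intro t)
  ... | inj₂ h = inj₂ h

  head : ∀ {n} {x : Fin (suc n)} {ρ : Perm n} → HeadOccurs₄ x (lookup ρ) (lookup σ) → σ ≼ x ◂ ρ
  head {x = x} {ρ} h = ⟨ occurs-resp (orderIso-sym (◂-orderIso x ρ)) orderIso-refl
    (₄⇒occurs σ-isPerm (headOccurs⇒₄ x {lookup ρ} {lookup σ} h)) ⟩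

p12 p21 : Perm 2
p12 = # 0 ∷ # 1 ∷ []
p21 = # 1 ∷ # 0 ∷ []

module P12 = Pattern₂ p12 (decide-isPerm p12)
module P21 = Pattern₂ p21 (decide-isPerm p21)
module P123 = Pattern₃ p123 (decide-isPerm p123)
module P132 = Pattern₃ p132 (decide-isPerm p132)
module P213 = Pattern₃ p213 (decide-isPerm p213)
module P231 = Pattern₃ p231 (decide-isPerm p231)
module P312 = Pattern₃ p312 (decide-isPerm p312)
module P321 = Pattern₃ p321 (decide-isPerm p321)
module P3412 = Pattern₄ p3412 (decide-isPerm p3412)
module P4231 = Pattern₄ p4231 (decide-isPerm p4231)
module P4321 = Pattern₄ p4321 (decide-isPerm p4321)

-- Generating trees

Class : Set₁
Class = ∀ {m} → Perm (suc m) → Set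

Extension : Set
Extension = ∀ {m} → Perm (suc m) → Perm (suc (suc m))

record Enumeration (Q : Class) (count : ℕ → ℕ) : Set where
  field
    members : ∀ m → List (Perm (suc m))
    unique : ∀ m → Unique (members m)
    sound : ∀ {m} {π : Perm (suc m)} → π ∈ members m → Q π
    complete : ∀ {m} {π : Perm (suc m)} → Q π → π ∈ members m
    length-members : ∀ m → length (members m) ≡ count m

Decomposition : Class → Class → Extension → Extension → Set
Decomposition Q Q′ old new = ∀ {m} {π : Perm (suc (suc m))} → Q π →
  (∃ λ ρ → Q ρ × π ≡ old ρ) ⊎ (∃ λ ρ → Q′ ρ × π ≡ new ρ)

record Grows (Q Q′ : Class) (old new : Extension) : Set where
  field
    base : Q (zero ∷ [])
    old-injective : ∀ {m} {ρ σ : Perm (suc m)} → old ρ ≡ old σ → ρ ≡ σ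
    new-injective : ∀ {m} {ρ σ : Perm (suc m)} → new ρ ≡ new σ → ρ ≡ σ
    old≢new : ∀ {m} (ρ σ : Perm (suc m)) → old ρ ≢ new σ
    old-closed : ∀ {m} {ρ : Perm (suc m)} → Q ρ → Q (old ρ)
    new-closed : ∀ {m} {ρ : Perm (suc m)} → Q′ ρ → Q (new ρ)
    decompose : Decomposition Q Q′ old new

accumulate : (ℕ → ℕ) → ℕ → ℕ
accumulate count zero = 1
accumulate count (suc m) = accumulate count m + count m

enumeration-empty : ∀ {Q : Class} → (∀ {m} {π : Perm (suc m)} → ¬ Q π) → Enumeration Q (λ _ → 0)
enumeration-empty ¬Q = record
  { members = λ _ → []
  ; unique = λ _ → []
  ; sound = λ ()
  ; complete = ⊥-elim ∘ ¬Q
  ; length-members = λ _ → refl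
  }

enumeration-grow : ∀ {Q Q′ : Class} {old new : Extension} {count : ℕ → ℕ} →
  Enumeration Q′ count → Grows Q Q′ old new → Enumeration Q (accumulate count)
enumeration-grow {Q} {Q′} {old} {new} {count} E′ G = record
  { members = members
  ; unique = unique
  ; sound = sound _
  ; complete = complete _ _
  ; length-members = length-members
  }
  where
  module E′ = Enumeration E′
  open Grows G

  members : ∀ m → List (Perm (suc m))
  members zero = (zero ∷ []) ∷ []
  members (suc m) = List.map old (members m) ++ List.map new (E′.members m)

  unique : ∀ m → Unique (members m)
  unique zero = All.[] ∷ []
  unique (suc m) = Uniqueₚ.++⁺ (Uniqueₚ.map⁺ old-injective (unique m)) (Uniqueₚ.map⁺ new-injective (E′.unique m))
    λ (∈old , ∈new) → disjoint (∈ₚ.∈-map⁻ old ∈old) (∈ₚ.∈-map⁻ new ∈new)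
    where
    disjoint : ∀ {π} → (∃ λ ρ → _ × π ≡ old ρ) → (∃ λ σ → _ × π ≡ new σ) → _
    disjoint (ρ , _ , π≡) (σ , _ , π≡′) = old≢new ρ σ (trans (sym π≡) π≡′)

  sound : ∀ m {π} → π ∈ members m → Q π
  sound zero (here refl) = base
  sound (suc m) π∈ with ∈ₚ.∈-++⁻ (List.map old (members m)) π∈
  ... | inj₁ ∈old with ∈ₚ.∈-map⁻ old ∈old
  ...   | ρ , ρ∈ , refl = old-closed (sound m ρ∈)
  sound (suc m) π∈ | inj₂ ∈new with ∈ₚ.∈-map⁻ new ∈new
  ...   | ρ , ρ∈ , refl = new-closed (E′.sound ρ∈)

  complete : ∀ m (π : Perm (suc m)) → Q π → π ∈ members m
  complete zero (zero ∷ []) _ = here refl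
  complete (suc m) π Qπ with decompose Qπ
  ... | inj₁ (ρ , Qρ , refl) = ∈ₚ.∈-++⁺ˡ (∈ₚ.∈-map⁺ old (complete m ρ Qρ))
  ... | inj₂ (ρ , Q′ρ , refl) = ∈ₚ.∈-++⁺ʳ (List.map old (members m)) (∈ₚ.∈-map⁺ new (E′.complete Q′ρ))

  length-members : ∀ m → length (members m) ≡ accumulate count m
  length-members zero = refl
  length-members (suc m) = begin
    length (List.map old (members m) ++ List.map new (E′.members m))
      ≡⟨ Listₚ.length-++ (List.map old (members m)) ⟩
    length (List.map old (members m)) + length (List.map new (E′.members m))
      ≡⟨ cong₂ _+_ (Listₚ.length-map old (members m)) (Listₚ.length-map new (E′.members m)) ⟩
    length (members m) + length (E′.members m)
      ≡⟨ cong₂ _+_ (length-members m) (E′.length-members m) ⟩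
    accumulate count m + count m ∎
    where open ≡-Reasoning

count₀ count₁ count₂ : ℕ → ℕ
count₀ = accumulate (λ _ → 0)
count₁ = accumulate count₀
count₂ = accumulate count₁

count₀≡1 : ∀ m → count₀ m ≡ 1
count₀≡1 zero = refl
count₀≡1 (suc m) = trans (ℕₚ.+-identityʳ (count₀ m)) (count₀≡1 m)

count₁≡suc : ∀ m → count₁ m ≡ suc m
count₁≡suc zero = refl
count₁≡suc (suc m) = trans (cong₂ _+_ (count₁≡suc m) (count₀≡1 m)) (ℕₚ.+-comm (suc m) 1)

count₂≡C2+1 : ∀ m → count₂ m ≡ suc m C 2 + 1
count₂≡C2+1 zero = refl
count₂≡C2+1 (suc m) = begin
  count₂ m + count₁ m               ≡⟨ cong₂ _+_ (count₂≡C2+1 m) (count₁≡suc m) ⟩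
  suc m C 2 + 1 + suc m             ≡⟨ ℕₚ.+-assoc (suc m C 2) 1 (suc m) ⟩
  suc m C 2 + (1 + suc m)           ≡⟨ cong (suc m C 2 +_) (ℕₚ.+-comm 1 (suc m)) ⟩
  suc m C 2 + (suc m + 1)           ≡⟨ ℕₚ.+-assoc (suc m C 2) (suc m) 1 ⟨
  suc m C 2 + suc m + 1             ≡⟨ cong (_+ 1) (ℕₚ.+-comm (suc m C 2) (suc m)) ⟩
  suc m + suc m C 2 + 1             ≡⟨ cong (λ k → k + suc m C 2 + 1) (nC1≡n (suc m)) ⟨
  suc m C 1 + suc m C 2 + 1         ≡⟨ cong (_+ 1) (nCk+nC[k+1]≡[n+1]C[k+1] (suc m) 1) ⟩
  suc (suc m) C 2 + 1               ∎
  where open ≡-Reasoning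

record Avoiding {a b c} (α : Perm a) (β : Perm b) (τ : Perm c) {n} (π : Perm n) : Set where
  constructor avoiding
  field
    isPerm : IsPerm π
    avoids₁ : α ⋠ π
    avoids₂ : β ⋠ π
    avoids₃ : τ ⋠ π
open Avoiding

⋠⇒avoids : ∀ {n k} (π : Perm n) (σ : Perm k) → σ ⋠ π → Avoids π σ
⋠⇒avoids π σ σ⋠π = σ⋠π ∘ contains⇒≼ {π = π} {σ}

avoids⇒⋠ : ∀ {n k} (π : Perm n) (σ : Perm k) → Avoids π σ → σ ⋠ π
avoids⇒⋠ π σ π-avoids = π-avoids ∘ ≼⇒contains {π = π} {σ}

Av3-≡ : ∀ {n a b c} {α : Perm a} {β : Perm b} {τ : Perm c} {x y : Av3 n α β τ} →
  Av3.perm x ≡ Av3.perm y → x ≡ y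
Av3-≡ {x = av π _ _ _ _} {av .π _ _ _ _} refl = refl

module _ {n a b c a′ b′ c′ : ℕ} {α : Perm a} {β : Perm b} {τ : Perm c}
         {α′ : Perm a′} {β′ : Perm b′} {τ′ : Perm c′} where

  Av3-map : (f : Perm n → Perm n) → (∀ {π} → Avoiding α β τ π → Avoiding α′ β′ τ′ (f π)) →
    Av3 n α β τ → Av3 n α′ β′ τ′
  Av3-map f F (av π π-perm α-av β-av τ-av) = av (f π) (isPerm (F′ π-perm α-av β-av τ-av))
    (⋠⇒avoids (f π) α′ (avoids₁ (F′ π-perm α-av β-av τ-av)))
    (⋠⇒avoids (f π) β′ (avoids₂ (F′ π-perm α-av β-av τ-av)))
    (⋠⇒avoids (f π) τ′ (avoids₃ (F′ π-perm α-av β-av τ-av)))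
    where
    F′ : IsPerm π → Avoids π α → Avoids π β → Avoids π τ → Avoiding α′ β′ τ′ (f π)
    F′ π-perm α-av β-av τ-av = F (avoiding π-perm (avoids⇒⋠ π α α-av) (avoids⇒⋠ π β β-av) (avoids⇒⋠ π τ τ-av))

Av3-↔ : ∀ {n a b c a′ b′ c′} {α : Perm a} {β : Perm b} {τ : Perm c}
  {α′ : Perm a′} {β′ : Perm b′} {τ′ : Perm c′}
  (f g : Perm n → Perm n) → (∀ π → f (g π) ≡ π) → (∀ π → g (f π) ≡ π) →
  (∀ {π} → Avoiding α β τ π → Avoiding α′ β′ τ′ (f π)) → (∀ {π} → Avoiding α′ β′ τ′ π → Avoiding α β τ (g π)) →
  Av3 n α β τ ↔ Av3 n α′ β′ τ′
Av3-↔ f g fg gf F G = mk↔ₛ′ (Av3-map f F) (Av3-map g G)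
  (λ { (av π _ _ _ _) → Av3-≡ (fg π) }) (λ { (av π _ _ _ _) → Av3-≡ (gf π) })

index-∈-lookup : ∀ {A : Set} (xs : List A) i → Any.index (∈ₚ.∈-lookup {xs = xs} i) ≡ i
index-∈-lookup (x ∷ xs) zero = refl
index-∈-lookup (x ∷ xs) (suc i) = cong suc (index-∈-lookup xs i)

enumeration⇒Av3↔ : ∀ {a b c} {α : Perm a} {β : Perm b} {τ : Perm c} {count : ℕ → ℕ} →
  Enumeration (Avoiding α β τ) count → ∀ m → Av3 (suc m) α β τ ↔ Fin (count m)
enumeration⇒Av3↔ {α = α} {β} {τ} {count} E m =
  subst (λ k → Av3 (suc m) α β τ ↔ Fin k) (length-members m) (mk↔ₛ′ to from to∘from from∘to)
  where
  open Enumeration E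
  L = members m

  _∈?L : ∀ π → Dec (π ∈ L)
  π ∈?L = any? (Vecₚ.≡-dec Fin._≟_ π) L

  member : ∀ π → IsPerm π → Avoids π α → Avoids π β → Avoids π τ → π ∈ L
  member π π-perm α-av β-av τ-av =
    complete (avoiding π-perm (avoids⇒⋠ π α α-av) (avoids⇒⋠ π β β-av) (avoids⇒⋠ π τ τ-av))

  -- The proofs in Av3 are irrelevant, so the index of π is found by deciding membership;
  -- completeness is only needed to refute the negative case.
  to : Av3 (suc m) α β τ → Fin (length L)
  to (av π π-perm α-av β-av τ-av) with π ∈?L
  ... | yes π∈ = Any.index π∈
  ... | no π∉ = Irrelevant.⊥-elim (π∉ (member π π-perm α-av β-av τ-av))

  from : Fin (length L) → Av3 (suc m) α β τ
  from i = av π (isPerm Q) (⋠⇒avoids π α (avoids₁ Q)) (⋠⇒avoids π β (avoids₂ Q)) (⋠⇒avoids π τ (avoids₃ Q))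
    where
    π = List.lookup L i
    Q = sound (∈ₚ.∈-lookup i)

  to∘from : ∀ i → to (from i) ≡ i
  to∘from i with List.lookup L i ∈?L
  ... | yes π∈ = trans (cong Any.index (Setoid∈ₚ.unique⇒irrelevant (setoid _)
                  (Decidable⇒UIP.≡-irrelevant (Vecₚ.≡-dec Fin._≟_)) (unique m) π∈ (∈ₚ.∈-lookup i)))
                  (index-∈-lookup L i)
  ... | no π∉ = ⊥-elim (π∉ (∈ₚ.∈-lookup i))

  from∘to : ∀ x → from (to x) ≡ x
  from∘to (av π π-perm α-av β-av τ-av) with π ∈?L
  ... | yes π∈ = Av3-≡ (sym (Anyₚ.lookup-index π∈))
  ... | no π∉ = Irrelevant.⊥-elim (π∉ (member π π-perm α-av β-av τ-av))

enumeration⇒card : ∀ {a b c} {α : Perm a} {β : Perm b} {τ : Perm c} →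
  Enumeration (Avoiding α β τ) count₂ → ∀ n → 1 ≤ n → HasCard n α β τ (n C 2 + 1)
enumeration⇒card {α = α} {β} {τ} E (suc m) _ =
  subst (λ k → Av3 (suc m) α β τ ↔ Fin k) (count₂≡C2+1 m) (enumeration⇒Av3↔ E m)

module _ {n a b c : ℕ} {α : Perm a} {β : Perm b} {τ : Perm c} where

  Av3-swap : Av3 n α β τ ↔ Av3 n β α τ
  Av3-swap = Av3-↔ id id (λ _ → refl) (λ _ → refl) swap swap
    where
    swap : ∀ {a b} {α : Perm a} {β : Perm b} {π : Perm n} → Avoiding α β τ π → Avoiding β α τ π
    swap (avoiding π-perm α⋠ β⋠ τ⋠) = avoiding π-perm β⋠ α⋠ τ⋠

  Av3-third : ∀ {c′} {τ′ : Perm c′} → α ≼ τ ⊎ β ≼ τ → α ≼ τ′ ⊎ β ≼ τ′ → Av3 n α β τ ↔ Av3 n α β τ′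
  Av3-third τ⊒ τ′⊒ = Av3-↔ id id (λ _ → refl) (λ _ → refl) (replace τ′⊒) (replace τ⊒)
    where
    replace : ∀ {c c′} {τ : Perm c} {τ′ : Perm c′} {π : Perm n} →
      α ≼ τ′ ⊎ β ≼ τ′ → Avoiding α β τ π → Avoiding α β τ′ π
    replace (inj₁ α≼τ′) (avoiding π-perm α⋠ β⋠ _) = avoiding π-perm α⋠ β⋠ (⋠-≼ α≼τ′ α⋠)
    replace (inj₂ β≼τ′) (avoiding π-perm α⋠ β⋠ _) = avoiding π-perm α⋠ β⋠ (⋠-≼ β≼τ′ β⋠)

  Av3-symmetry : (φ : ∀ {k} → Perm k → Perm k) → (∀ {k} (π : Perm k) → φ (φ π) ≡ π) →
    (∀ {k} (π : Perm k) → IsPerm π → IsPerm (φ π)) →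
    (∀ {j k} {σ : Perm j} {π : Perm k} → σ ≼ π → φ σ ≼ φ π) →
    Av3 n α β τ ↔ Av3 n (φ α) (φ β) (φ τ)
  Av3-symmetry φ φ-involutive φ-isPerm φ-≼ = Av3-↔ φ φ φ-involutive φ-involutive to from
    where
    to : ∀ {π : Perm n} → Avoiding α β τ π → Avoiding (φ α) (φ β) (φ τ) (φ π)
    to (avoiding π-perm α⋠ β⋠ τ⋠) = avoiding (φ-isPerm _ π-perm) (α⋠ ∘ φ-≼⁻) (β⋠ ∘ φ-≼⁻) (τ⋠ ∘ φ-≼⁻)
      where
      φ-≼⁻ : ∀ {j k} {σ : Perm j} {π : Perm k} → φ σ ≼ φ π → σ ≼ π
      φ-≼⁻ {σ = σ} {π} = subst₂ _≼_ (φ-involutive σ) (φ-involutive π) ∘ φ-≼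
    from : ∀ {π : Perm n} → Avoiding (φ α) (φ β) (φ τ) π → Avoiding α β τ (φ π)
    from (avoiding π-perm α⋠ β⋠ τ⋠) = avoiding (φ-isPerm _ π-perm) (α⋠ ∘ φ-≼ʳ) (β⋠ ∘ φ-≼ʳ) (τ⋠ ∘ φ-≼ʳ)
      where
      φ-≼ʳ : ∀ {j k} {σ : Perm j} {π : Perm k} → σ ≼ φ π → φ σ ≼ π
      φ-≼ʳ {π = π} = subst (_ ≼_) (φ-involutive π) ∘ φ-≼

  Av3-reverse : Av3 n α β τ ↔ Av3 n (reverse α) (reverse β) (reverse τ)
  Av3-reverse = Av3-symmetry reverse reverse-involutive reverse-isPerm reverse-≼

  Av3-complement : Av3 n α β τ ↔ Av3 n (complement α) (complement β) (complement τ)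
  Av3-complement = Av3-symmetry complement complement-involutive complement-isPerm complement-≼

-- Prepending a new entry just below the entry v of ρ.
insertBelow : ∀ {m} → Fin (suc m) → Perm (suc m) → Perm (suc (suc m))
insertBelow v ρ = inject₁ v ◂ ρ

Entry : Set
Entry = ∀ {m} → Perm (suc m) → Fin (suc m)

firstEntry lastEntry maxEntry : Entry
firstEntry ρ = lookup ρ zero
lastEntry {m} ρ = lookup ρ (fromℕ m)
maxEntry {m} _ = fromℕ m

prependBelow : Entry → Extension
prependBelow entry ρ = insertBelow (entry ρ) ρ

belowFirst belowLast belowMax : Extension
belowFirst = prependBelow firstEntry
belowLast = prependBelow lastEntry
belowMax = prependBelow maxEntry

maxFirst-injective : ∀ {m} {ρ σ : Perm m} → maxFirst ρ ≡ maxFirst σ → ρ ≡ σ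
maxFirst-injective = proj₂ ∘ ◂-injective

maxLast-injective : ∀ {m} {ρ σ : Perm m} → maxLast ρ ≡ maxLast σ → ρ ≡ σ
maxLast-injective {ρ = ρ} {σ} e = trans (sym (reverse-involutive ρ))
  (trans (cong reverse (maxFirst-injective (trans (sym (reverse-involutive _)) (trans (cong reverse e) (reverse-involutive _)))))
    (reverse-involutive σ))

prependBelow-injective : ∀ (entry : Entry) {m} {ρ σ : Perm (suc m)} →
  prependBelow entry ρ ≡ prependBelow entry σ → ρ ≡ σ
prependBelow-injective entry = proj₂ ∘ ◂-injective

maxFirst≢prependBelow : ∀ (entry : Entry) {m} (ρ σ : Perm (suc m)) → maxFirst ρ ≢ prependBelow entry σ
maxFirst≢prependBelow entry ρ σ = Finₚ.fromℕ≢inject₁ ∘ proj₁ ∘ ◂-injective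

maxFirst≢maxLast : ∀ {m} (ρ σ : Perm (suc m)) → maxFirst ρ ≢ maxLast σ
maxFirst≢maxLast {m} ρ σ e = Finₚ.punchInᵢ≢i (fromℕ (suc m)) (lookup (reverse σ) (fromℕ m)) (sym (begin
  fromℕ (suc m)                                                   ≡⟨ cong (λ π → lookup π zero) e ⟩
  lookup (maxLast σ) zero                                         ≡⟨ lookup-reverse (maxFirst (reverse σ)) zero ⟩
  lookup (maxFirst (reverse σ)) (fromℕ (suc m))                   ≡⟨ lookup-◂ _ (reverse σ) (suc (fromℕ m)) ⟩
  punchIn (fromℕ (suc m)) (lookup (reverse σ) (fromℕ m))          ∎))
  where open ≡-Reasoning

maxFirst-isPerm : ∀ {m} (ρ : Perm m) → IsPerm ρ → IsPerm (maxFirst ρ)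
maxFirst-isPerm ρ = ◂-isPerm _ ρ

maxLast-isPerm : ∀ {m} (ρ : Perm m) → IsPerm ρ → IsPerm (maxLast ρ)
maxLast-isPerm ρ = reverse-isPerm (maxFirst (reverse ρ)) ∘ maxFirst-isPerm (reverse ρ) ∘ reverse-isPerm ρ

startsBelowMax-maxLast : ∀ {k} (σ : Perm (suc k)) → StartsBelowMax (maxLast σ)
startsBelowMax-maxLast {k} σ = fromℕ (suc k) , subst₂ _<_ (sym first) (sym last) (punchIn-fromℕ< _)
  where
  first : lookup (maxLast σ) zero ≡ punchIn (fromℕ (suc k)) (lookup (reverse σ) (fromℕ k))
  first = trans (lookup-reverse (maxFirst (reverse σ)) zero) (lookup-◂ _ (reverse σ) (suc (fromℕ k)))
  last : lookup (maxLast σ) (fromℕ (suc k)) ≡ fromℕ (suc k)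
  last = trans (lookup-reverse (maxFirst (reverse σ)) (fromℕ (suc k)))
    (cong (lookup (maxFirst (reverse σ))) (Finₚ.opposite-involutive zero))

endsBelowMax-maxFirst : ∀ {k} (σ : Perm (suc k)) → EndsBelowMax (maxFirst σ)
endsBelowMax-maxFirst σ =
  subst StartsBelowMax (cong (reverse ∘ maxFirst) (reverse-involutive σ)) (startsBelowMax-maxLast (reverse σ))

module _ {a b} {α : Perm (suc (suc a))} {β : Perm (suc (suc b))} where

  avoiding-singleton : ∀ {c} {τ : Perm (suc (suc c))} → Avoiding α β τ (zero ∷ [])
  avoiding-singleton {τ = τ} = avoiding (λ { {zero} {zero} _ → refl }) (⋠-singleton α) (⋠-singleton β) (⋠-singleton τ)

  enumeration-none : Enumeration (Avoiding α β (zero ∷ [])) (λ _ → 0)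
  enumeration-none = enumeration-empty λ A → avoids₃ A (singleton-≼ _)

  module _ {c} {τ : Perm c} {m} {ρ : Perm m} where

    avoiding-◂⁻ : ∀ {x} → IsPerm ρ → Avoiding α β τ (x ◂ ρ) → Avoiding α β τ ρ
    avoiding-◂⁻ ρ-perm (avoiding _ α⋠ β⋠ τ⋠) = avoiding ρ-perm (⋠-◂⁻ α⋠) (⋠-◂⁻ β⋠) (⋠-◂⁻ τ⋠)

    avoiding-maxLast⁻ : IsPerm ρ → Avoiding α β τ (maxLast ρ) → Avoiding α β τ ρ
    avoiding-maxLast⁻ ρ-perm (avoiding _ α⋠ β⋠ τ⋠) = avoiding ρ-perm (⋠-maxLast⁻ α⋠) (⋠-maxLast⁻ β⋠) (⋠-maxLast⁻ τ⋠)

    avoiding-maxFirst-maxFirst : StartsBelowMax α → StartsBelowMax β →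
      Avoiding α β τ ρ → Avoiding α β (maxFirst τ) (maxFirst ρ)
    avoiding-maxFirst-maxFirst α< β< (avoiding ρ-perm α⋠ β⋠ τ⋠) = avoiding (maxFirst-isPerm ρ ρ-perm)
      (maxFirst-⋠ α< α⋠) (maxFirst-⋠ β< β⋠) (maxFirst-⋠-maxFirst (⋠-≼ (≼-◂ ≼-refl) τ⋠) τ⋠)

    avoiding-maxFirst-maxFirst⁻ : IsPerm ρ → Avoiding α β (maxFirst τ) (maxFirst ρ) → Avoiding α β τ ρ
    avoiding-maxFirst-maxFirst⁻ ρ-perm (avoiding _ α⋠ β⋠ τ⋠) =
      avoiding ρ-perm (⋠-◂⁻ α⋠) (⋠-◂⁻ β⋠) (maxFirst-⋠-maxFirst⁻ τ⋠)

    avoiding-maxLast-maxLast : EndsBelowMax α → EndsBelowMax β →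
      Avoiding α β τ ρ → Avoiding α β (maxLast τ) (maxLast ρ)
    avoiding-maxLast-maxLast α< β< (avoiding ρ-perm α⋠ β⋠ τ⋠) = avoiding (maxLast-isPerm ρ ρ-perm)
      (maxLast-⋠ α< α⋠) (maxLast-⋠ β< β⋠) (maxLast-⋠-maxLast (⋠-≼ (≼-maxLast ≼-refl) τ⋠) τ⋠)

    avoiding-maxLast-maxLast⁻ : IsPerm ρ → Avoiding α β (maxLast τ) (maxLast ρ) → Avoiding α β τ ρ
    avoiding-maxLast-maxLast⁻ ρ-perm (avoiding _ α⋠ β⋠ τ⋠) =
      avoiding ρ-perm (⋠-maxLast⁻ α⋠) (⋠-maxLast⁻ β⋠) (maxLast-⋠-maxLast⁻ τ⋠)

  module _ {c} {τ : Perm (suc c)} {m} {ρ : Perm m} where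

    avoiding-maxFirst : StartsBelowMax α → StartsBelowMax β → StartsBelowMax τ →
      Avoiding α β τ ρ → Avoiding α β τ (maxFirst ρ)
    avoiding-maxFirst α< β< τ< (avoiding ρ-perm α⋠ β⋠ τ⋠) =
      avoiding (maxFirst-isPerm ρ ρ-perm) (maxFirst-⋠ α< α⋠) (maxFirst-⋠ β< β⋠) (maxFirst-⋠ τ< τ⋠)

    avoiding-maxLast : EndsBelowMax α → EndsBelowMax β → EndsBelowMax τ →
      Avoiding α β τ ρ → Avoiding α β τ (maxLast ρ)
    avoiding-maxLast α< β< τ< (avoiding ρ-perm α⋠ β⋠ τ⋠) =
      avoiding (maxLast-isPerm ρ ρ-perm) (maxLast-⋠ α< α⋠) (maxLast-⋠ β< β⋠) (maxLast-⋠ τ< τ⋠)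

p12-startsBelowMax : StartsBelowMax p12
p12-startsBelowMax = # 1 , ℕ.z<s

p123-startsBelowMax : StartsBelowMax p123
p123-startsBelowMax = # 1 , ℕ.z<s

p132-startsBelowMax : StartsBelowMax p132
p132-startsBelowMax = # 1 , ℕ.z<s

p213-startsBelowMax : StartsBelowMax p213
p213-startsBelowMax = # 2 , ℕ.s<s ℕ.z<s

p231-startsBelowMax : StartsBelowMax p231
p231-startsBelowMax = # 1 , ℕ.s<s ℕ.z<s

p3412-startsBelowMax : StartsBelowMax p3412
p3412-startsBelowMax = # 1 , ℕ.s<s (ℕ.s<s ℕ.z<s)

p132-endsBelowMax : EndsBelowMax p132
p132-endsBelowMax = # 1 , ℕ.s<s ℕ.z<s

p231-endsBelowMax : EndsBelowMax p231
p231-endsBelowMax = # 1 , ℕ.z<s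

<-max : ∀ {m} (π : Perm (suc m)) → IsPerm π → ∀ {i q} → lookup π q ≡ fromℕ m → i ≢ q →
  lookup π i < lookup π q
<-max π π-perm {i} πq≡max i≢q = subst (lookup π i <_) (sym πq≡max)
  (Finₚ.≤∧≢⇒< (Finₚ.≤fromℕ _) (λ πi≡max → i≢q (π-perm (trans πi≡max (sym πq≡max)))))

module Entries {m} (ρ : Perm (suc m)) (ρ-perm : IsPerm ρ) where

  last : Fin (suc m)
  last = fromℕ m

  distinct : ∀ {i j} → i ≢ j → toℕ (lookup ρ i) ≢ toℕ (lookup ρ j)
  distinct i≢j = i≢j ∘ ρ-perm ∘ Finₚ.toℕ-injective

  <⇒≢last : ∀ {i j : Fin (suc m)} → i < j → i ≢ last
  <⇒≢last {i} {j} i<j refl = ℕₚ.<⇒≱ i<j (Finₚ.≤fromℕ j)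

  ≢last⇒< : ∀ {i} → i ≢ last → i < last
  ≢last⇒< {i} = Finₚ.≤∧≢⇒< (Finₚ.≤fromℕ i)

  <⇒0< : ∀ {i j : Fin (suc m)} → i < j → zero {m} < j
  <⇒0< = ℕₚ.≤-<-trans z≤n

  ≢0⇒0< : ∀ {j : Fin (suc m)} → j ≢ zero → zero {m} < j
  ≢0⇒0< j≢0 = ℕₚ.n≢0⇒n>0 (j≢0 ∘ Finₚ.toℕ-injective)

  position : ∀ v → ∃ λ i → lookup ρ i ≡ v
  position = lookup-surjective ρ ρ-perm

module _ {n k} {v : Fin n} {u : Fin k} where

  inject₁-≤⁻ : inject₁ v Fin.≤ u → v Fin.≤ u
  inject₁-≤⁻ = subst (ℕ._≤ toℕ u) (Finₚ.toℕ-inject₁ v)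

  inject₁-≤ : v Fin.≤ u → inject₁ v Fin.≤ u
  inject₁-≤ = subst (ℕ._≤ toℕ u) (sym (Finₚ.toℕ-inject₁ v))

  <-inject₁⁻ : u < inject₁ v → u < v
  <-inject₁⁻ = subst (toℕ u ℕ.<_) (Finₚ.toℕ-inject₁ v)

  <-inject₁ : u < v → u < inject₁ v
  <-inject₁ = subst (toℕ u ℕ.<_) (sym (Finₚ.toℕ-inject₁ v))

maxFirst-or-insertBelow : ∀ {m} {π : Perm (suc (suc m))} → IsPerm π →
  ∃ λ ρ → IsPerm ρ × (π ≡ maxFirst ρ ⊎ ∃ λ v → π ≡ insertBelow v ρ)
maxFirst-or-insertBelow {m} {π} π-perm with ◂-decompose π π-perm
... | x , ρ , ρ-perm , refl with x Fin.≟ fromℕ (suc m)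
...   | yes refl = ρ , ρ-perm , inj₁ refl
...   | no x≢max = ρ , ρ-perm , inj₂ (Fin.lower₁ x sm≢x , cong (_◂ ρ) (sym (Finₚ.inject₁-lower₁ x sm≢x)))
  where
  sm≢x : suc m ≢ toℕ x
  sm≢x sm≡x = x≢max (Finₚ.toℕ-injective (trans (sym sm≡x) (sym (Finₚ.toℕ-fromℕ (suc m)))))

p12-≼-insertBelow : ∀ {m} (ρ : Perm (suc m)) → IsPerm ρ → ∀ v → p12 ≼ insertBelow v ρ
p12-≼-insertBelow ρ ρ-perm v with lookup-surjective ρ ρ-perm v
... | j , ρj≡v = P12.head (j , inject₁-≤ (ℕₚ.≤-reflexive (cong toℕ (sym ρj≡v))))

enumeration-from-growths : ∀ {a b} {α : Perm (suc (suc a))} {β : Perm (suc (suc b))} {Q₀ Q₁ Q₂ : Class}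
  {old₀ new₀ old₁ new₁ old₂ new₂ : Extension} → Grows Q₀ (Avoiding α β (zero ∷ [])) old₀ new₀ →
  Grows Q₁ Q₀ old₁ new₁ → Grows Q₂ Q₁ old₂ new₂ → Enumeration Q₂ count₂
enumeration-from-growths G₀ G₁ G₂ = enumeration-grow (enumeration-grow (enumeration-grow enumeration-none G₀) G₁) G₂

-- Av(132, 231)

lookup-zero-max⇒maxFirst : ∀ {m} (π : Perm (suc m)) → IsPerm π → lookup π zero ≡ fromℕ m →
  ∃ λ ρ → IsPerm ρ × π ≡ maxFirst ρ
lookup-zero-max⇒maxFirst π π-perm π₀≡max with ◂-decompose π π-perm
... | x , ρ , ρ-perm , refl = ρ , ρ-perm , cong (_◂ ρ) π₀≡max

-- An interior maximum would be the 3 of a 132 or of a 231.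
maxFirst-or-maxLast : ∀ {m} {π : Perm (suc (suc m))} → IsPerm π → p132 ⋠ π → p231 ⋠ π →
  ∃ λ ρ → IsPerm ρ × (π ≡ maxFirst ρ ⊎ π ≡ maxLast ρ)
maxFirst-or-maxLast {m} {π} π-perm 132⋠ 231⋠ with lookup-surjective π π-perm (fromℕ (suc m))
... | q , πq≡max with q Fin.≟ zero | q Fin.≟ fromℕ (suc m)
...   | yes refl | _ with lookup-zero-max⇒maxFirst π π-perm πq≡max
...     | ρ , ρ-perm , π≡ = ρ , ρ-perm , inj₁ π≡
maxFirst-or-maxLast {m} {π} π-perm 132⋠ 231⋠ | q , πq≡max | no q≢0 | yes refl
  with lookup-zero-max⇒maxFirst (reverse π) (reverse-isPerm π π-perm) (trans (lookup-reverse π zero) πq≡max)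
... | ρ , ρ-perm , πʳ≡ = reverse ρ , reverse-isPerm ρ ρ-perm , inj₂ (begin
  π                             ≡⟨ reverse-involutive π ⟨
  reverse (reverse π)           ≡⟨ cong reverse πʳ≡ ⟩
  reverse (maxFirst ρ)          ≡⟨ cong (reverse ∘ maxFirst) (reverse-involutive ρ) ⟨
  maxLast (reverse ρ)           ∎)
  where open ≡-Reasoning
maxFirst-or-maxLast {m} {π} π-perm 132⋠ 231⋠ | q , πq≡max | no q≢0 | no q≢last
  with Finₚ.<-cmp (lookup π zero) (lookup π (fromℕ (suc m)))
... | tri< π₀<πₗ _ _ = ⊥-elim (132⋠ (P132.intro (zero , q , fromℕ (suc m) , 0<q , q<last ,
        <-max π π-perm πq≡max (q≢0 ∘ sym) , π₀<πₗ , <-max π π-perm πq≡max (q≢last ∘ sym))))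
  where
  0<q = ℕₚ.n≢0⇒n>0 (q≢0 ∘ Finₚ.toℕ-injective)
  q<last = Finₚ.≤∧≢⇒< (Finₚ.≤fromℕ q) q≢last
... | tri> _ _ πₗ<π₀ = ⊥-elim (231⋠ (P231.intro (zero , q , fromℕ (suc m) , 0<q , q<last ,
        <-max π π-perm πq≡max (q≢0 ∘ sym) , πₗ<π₀ , <-max π π-perm πq≡max (q≢last ∘ sym))))
  where
  0<q = ℕₚ.n≢0⇒n>0 (q≢0 ∘ Finₚ.toℕ-injective)
  q<last = Finₚ.≤∧≢⇒< (Finₚ.≤fromℕ q) q≢last
... | tri≈ _ π₀≡πₗ _ with π-perm π₀≡πₗ
...   | ()

module _ {k} {τ : Perm (suc k)} where

  grows-132-231-maxLast : Grows (Avoiding p132 p231 (maxLast τ)) (Avoiding p132 p231 τ) maxFirst maxLast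
  grows-132-231-maxLast = record
    { base = avoiding-singleton
    ; old-injective = maxFirst-injective
    ; new-injective = maxLast-injective
    ; old≢new = maxFirst≢maxLast
    ; old-closed = avoiding-maxFirst p132-startsBelowMax p231-startsBelowMax (startsBelowMax-maxLast τ)
    ; new-closed = avoiding-maxLast-maxLast p132-endsBelowMax p231-endsBelowMax
    ; decompose = decompose
    }
    where
    decompose : Decomposition (Avoiding p132 p231 (maxLast τ)) (Avoiding p132 p231 τ) maxFirst maxLast
    decompose A with maxFirst-or-maxLast (isPerm A) (avoids₁ A) (avoids₂ A)
    ... | ρ , ρ-perm , inj₁ refl = inj₁ (ρ , avoiding-◂⁻ ρ-perm A , refl)
    ... | ρ , ρ-perm , inj₂ refl = inj₂ (ρ , avoiding-maxLast-maxLast⁻ ρ-perm A , refl)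

  grows-132-231-maxFirst : Grows (Avoiding p132 p231 (maxFirst τ)) (Avoiding p132 p231 τ) maxLast maxFirst
  grows-132-231-maxFirst = record
    { base = avoiding-singleton
    ; old-injective = maxLast-injective
    ; new-injective = maxFirst-injective
    ; old≢new = λ ρ σ → maxFirst≢maxLast σ ρ ∘ sym
    ; old-closed = avoiding-maxLast p132-endsBelowMax p231-endsBelowMax (endsBelowMax-maxFirst τ)
    ; new-closed = avoiding-maxFirst-maxFirst p132-startsBelowMax p231-startsBelowMax
    ; decompose = decompose
    }
    where
    decompose : Decomposition (Avoiding p132 p231 (maxFirst τ)) (Avoiding p132 p231 τ) maxLast maxFirst
    decompose A with maxFirst-or-maxLast (isPerm A) (avoids₁ A) (avoids₂ A)
    ... | ρ , ρ-perm , inj₁ refl = inj₂ (ρ , avoiding-maxFirst-maxFirst⁻ ρ-perm A , refl)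
    ... | ρ , ρ-perm , inj₂ refl = inj₁ (ρ , avoiding-maxLast⁻ ρ-perm A , refl)

enumeration-132-231-1234 : Enumeration (Avoiding p132 p231 p1234) count₂
enumeration-132-231-1234 = enumeration-from-growths grows-132-231-maxLast grows-132-231-maxLast grows-132-231-maxLast

enumeration-132-231-2134 : Enumeration (Avoiding p132 p231 p2134) count₂
enumeration-132-231-2134 = enumeration-from-growths grows-132-231-maxFirst grows-132-231-maxLast grows-132-231-maxLast

enumeration-132-231-3124 : Enumeration (Avoiding p132 p231 p3124) count₂
enumeration-132-231-3124 = enumeration-from-growths grows-132-231-maxLast grows-132-231-maxFirst grows-132-231-maxLast

enumeration-132-231-3214 : Enumeration (Avoiding p132 p231 p3214) count₂
enumeration-132-231-3214 = enumeration-from-growths grows-132-231-maxFirst grows-132-231-maxFirst grows-132-231-maxLast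

-- Av(123, 231)

-- The new head of belowLast ρ has the value of the last entry of ρ, so the other entries of
-- an occurrence using the head form, with that last entry, another forbidden pattern in ρ.
module _ {m} (ρ : Perm (suc m)) (ρ-perm : IsPerm ρ) where

  open Entries ρ ρ-perm

  private
    f = lookup ρ
    w = lookup ρ last

  insertBelow-⋠⇒≡last : ∀ {v} → p123 ⋠ insertBelow v ρ → p231 ⋠ insertBelow v ρ → v ≡ w
  insertBelow-⋠⇒≡last {v} 123⋠ 231⋠ with position v | Finₚ.<-cmp v w
  ... | _ | tri≈ _ v≡w _ = v≡w
  ... | j , fj≡v | tri< v<w _ _ = ⊥-elim (123⋠ (P123.head (j , last , ≢last⇒< j≢last ,
        subst (_< w) (sym fj≡v) v<w , inject₁-≤ (ℕₚ.≤-reflexive (cong toℕ (sym fj≡v))) , inject₁-≤ (ℕₚ.<⇒≤ v<w))))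
    where
    j≢last : j ≢ last
    j≢last refl = ℕₚ.<-irrefl (cong toℕ (sym fj≡v)) v<w
  ... | j , fj≡v | tri> _ _ w<v = ⊥-elim (231⋠ (P231.head (j , last , ≢last⇒< j≢last ,
        subst (w <_) (sym fj≡v) w<v , inject₁-≤ (ℕₚ.≤-reflexive (cong toℕ (sym fj≡v))) , <-inject₁ w<v)))
    where
    j≢last : j ≢ last
    j≢last refl = ℕₚ.<-irrefl (cong toℕ fj≡v) w<v

  belowLast-⋠123 : p123 ⋠ ρ → p231 ⋠ ρ → p123 ⋠ belowLast ρ
  belowLast-⋠123 123⋠ 231⋠ c with P123.split (inject₁ w) ρ c
  ... | inj₁ c′ = 123⋠ c′
  ... | inj₂ (j , l , j<l , fj<fl , x≤fj , _) =
        231⋠ (P231.intro (j , l , last , j<l , ≢last⇒< l≢last , fj<fl , w<fj , ℕₚ.<-trans w<fj fj<fl))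
    where
    w<fj : w < f j
    w<fj = ℕₚ.≤∧≢⇒< (inject₁-≤⁻ x≤fj) (distinct (<⇒≢last j<l) ∘ sym)
    l≢last : l ≢ last
    l≢last refl = ℕₚ.<-asym w<fj fj<fl

  belowLast-⋠231 : p231 ⋠ ρ → p312 ⋠ ρ → p231 ⋠ belowLast ρ
  belowLast-⋠231 231⋠ 312⋠ c with P231.split (inject₁ w) ρ c
  ... | inj₁ c′ = 231⋠ c′
  ... | inj₂ (j , l , j<l , fl<fj , x≤fj , fl<x) =
        312⋠ (P312.intro (j , l , last , j<l , ≢last⇒< l≢last , fl<fj , w<fj , fl<w))
    where
    w<fj : w < f j
    w<fj = ℕₚ.≤∧≢⇒< (inject₁-≤⁻ x≤fj) (distinct (<⇒≢last j<l) ∘ sym)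
    fl<w : f l < w
    fl<w = <-inject₁⁻ fl<x
    l≢last : l ≢ last
    l≢last refl = ℕₚ.<-irrefl refl fl<w

  belowLast-⋠312 : p123 ⋠ ρ → p312 ⋠ ρ → p312 ⋠ belowLast ρ
  belowLast-⋠312 123⋠ 312⋠ c with P312.split (inject₁ w) ρ c
  ... | inj₁ c′ = 312⋠ c′
  ... | inj₂ (j , l , j<l , fj<fl , _ , fl<x) =
        123⋠ (P123.intro (j , l , last , j<l , ≢last⇒< l≢last , fj<fl , ℕₚ.<-trans fj<fl fl<w , fl<w))
    where
    fl<w : f l < w
    fl<w = <-inject₁⁻ fl<x
    l≢last : l ≢ last
    l≢last refl = ℕₚ.<-irrefl refl fl<w

  belowLast-⋠⇒⋠312 : p123 ⋠ belowLast ρ → p231 ⋠ belowLast ρ → p312 ⋠ ρ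
  belowLast-⋠⇒⋠312 123⋠ 231⋠ c with P312.elim c
  ... | i , j , l , i<j , j<l , fj<fi , fl<fi , fj<fl with Finₚ.<-cmp w (f j)
  ...   | tri< w<fj _ _ = 123⋠ (P123.head (j , l , j<l , fj<fl ,
          inject₁-≤ (ℕₚ.<⇒≤ w<fj) , inject₁-≤ (ℕₚ.<⇒≤ (ℕₚ.<-trans w<fj fj<fl))))
  ...   | tri≈ _ w≡fj _ = <⇒≢last j<l (sym (ρ-perm w≡fj))
  ...   | tri> _ _ fj<w with Finₚ.<-cmp w (f i)
  ...     | tri< w<fi _ _ = 231⋠ (P231.head (i , j , i<j , fj<fi , inject₁-≤ (ℕₚ.<⇒≤ w<fi) , <-inject₁ fj<w))
  ...     | tri≈ _ w≡fi _ = <⇒≢last (ℕₚ.<-trans i<j j<l) (sym (ρ-perm w≡fi))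
  ...     | tri> _ _ fi<w =
            ⋠-◂⁻ 123⋠ (P123.intro (j , l , last , j<l , ≢last⇒< l≢last , fj<fl , ℕₚ.<-trans fj<fl fl<w , fl<w))
    where
    fl<w : f l < w
    fl<w = ℕₚ.<-trans fl<fi fi<w
    l≢last : l ≢ last
    l≢last refl = ℕₚ.<-irrefl refl fl<w

maxFirst-or-belowLast : ∀ {m} {π : Perm (suc (suc m))} → IsPerm π → p123 ⋠ π → p231 ⋠ π →
  ∃ λ ρ → IsPerm ρ × (π ≡ maxFirst ρ ⊎ π ≡ belowLast ρ)
maxFirst-or-belowLast π-perm 123⋠ 231⋠ with maxFirst-or-insertBelow π-perm
... | ρ , ρ-perm , inj₁ π≡ = ρ , ρ-perm , inj₁ π≡
... | ρ , ρ-perm , inj₂ (v , refl) =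
      ρ , ρ-perm , inj₂ (cong (λ v → insertBelow v ρ) (insertBelow-⋠⇒≡last ρ ρ-perm 123⋠ 231⋠))

grows-123-231-12 : Grows (Avoiding p123 p231 p12) (Avoiding p123 p231 (zero ∷ [])) maxFirst belowLast
grows-123-231-12 = record
  { base = avoiding-singleton
  ; old-injective = maxFirst-injective
  ; new-injective = prependBelow-injective lastEntry
  ; old≢new = maxFirst≢prependBelow lastEntry
  ; old-closed = avoiding-maxFirst p123-startsBelowMax p231-startsBelowMax p12-startsBelowMax
  ; new-closed = λ A → ⊥-elim (avoids₃ A (singleton-≼ _))
  ; decompose = decompose
  }
  where
  decompose : Decomposition (Avoiding p123 p231 p12) (Avoiding p123 p231 (zero ∷ [])) maxFirst belowLast
  decompose A with maxFirst-or-belowLast (isPerm A) (avoids₁ A) (avoids₂ A)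
  ... | ρ , ρ-perm , inj₁ refl = inj₁ (ρ , avoiding-◂⁻ ρ-perm A , refl)
  ... | ρ , ρ-perm , inj₂ refl = ⊥-elim (avoids₃ A (p12-≼-insertBelow ρ ρ-perm _))

grows-123-231-312 : Grows (Avoiding p123 p231 p312) (Avoiding p123 p231 p12) belowLast maxFirst
grows-123-231-312 = record
  { base = avoiding-singleton
  ; old-injective = prependBelow-injective lastEntry
  ; new-injective = maxFirst-injective
  ; old≢new = λ ρ σ → maxFirst≢prependBelow lastEntry σ ρ ∘ sym
  ; old-closed = λ { (avoiding ρ-perm 123⋠ 231⋠ 312⋠) → avoiding (◂-isPerm _ _ ρ-perm)
      (belowLast-⋠123 _ ρ-perm 123⋠ 231⋠) (belowLast-⋠231 _ ρ-perm 231⋠ 312⋠) (belowLast-⋠312 _ ρ-perm 123⋠ 312⋠) }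
  ; new-closed = avoiding-maxFirst-maxFirst p123-startsBelowMax p231-startsBelowMax
  ; decompose = decompose
  }
  where
  decompose : Decomposition (Avoiding p123 p231 p312) (Avoiding p123 p231 p12) belowLast maxFirst
  decompose A with maxFirst-or-belowLast (isPerm A) (avoids₁ A) (avoids₂ A)
  ... | ρ , ρ-perm , inj₁ refl = inj₂ (ρ , avoiding-maxFirst-maxFirst⁻ ρ-perm A , refl)
  ... | ρ , ρ-perm , inj₂ refl = inj₁ (ρ , avoiding-◂⁻ ρ-perm A , refl)

grows-123-231-123 : Grows (Avoiding p123 p231 p123) (Avoiding p123 p231 p312) maxFirst belowLast
grows-123-231-123 = record
  { base = avoiding-singleton
  ; old-injective = maxFirst-injective
  ; new-injective = prependBelow-injective lastEntry
  ; old≢new = maxFirst≢prependBelow lastEntry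
  ; old-closed = avoiding-maxFirst p123-startsBelowMax p231-startsBelowMax p123-startsBelowMax
  ; new-closed = λ { (avoiding ρ-perm 123⋠ 231⋠ 312⋠) → avoiding (◂-isPerm _ _ ρ-perm)
      (belowLast-⋠123 _ ρ-perm 123⋠ 231⋠) (belowLast-⋠231 _ ρ-perm 231⋠ 312⋠) (belowLast-⋠123 _ ρ-perm 123⋠ 231⋠) }
  ; decompose = decompose
  }
  where
  decompose : Decomposition (Avoiding p123 p231 p123) (Avoiding p123 p231 p312) maxFirst belowLast
  decompose A with maxFirst-or-belowLast (isPerm A) (avoids₁ A) (avoids₂ A)
  ... | ρ , ρ-perm , inj₁ refl = inj₁ (ρ , avoiding-◂⁻ ρ-perm A , refl)
  ... | ρ , ρ-perm , inj₂ refl = inj₂ (ρ , avoiding ρ-perm (⋠-◂⁻ (avoids₁ A)) (⋠-◂⁻ (avoids₂ A))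
          (belowLast-⋠⇒⋠312 ρ ρ-perm (avoids₁ A) (avoids₂ A)) , refl)

enumeration-123-231 : Enumeration (Avoiding p123 p231 p123) count₂
enumeration-123-231 = enumeration-from-growths grows-123-231-12 grows-123-231-312 grows-123-231-123

-- Av(123, 132)

inject₁-fromℕ≤⇒≡ : ∀ {m} {u : Fin (suc m)} → inject₁ (fromℕ m) Fin.≤ u → u ≡ fromℕ m
inject₁-fromℕ≤⇒≡ {u = u} x≤u = Finₚ.≤-antisym (Finₚ.≤fromℕ u) (inject₁-≤⁻ x≤u)

module _ {m} (ρ : Perm (suc m)) (ρ-perm : IsPerm ρ) where

  open Entries ρ ρ-perm

  private
    f = lookup ρ
    x = inject₁ (fromℕ m)

    no-two-maxima : ∀ {j l} → j < l → x Fin.≤ f j → x Fin.≤ f l → ⊥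
    no-two-maxima j<l x≤fj x≤fl =
      ℕₚ.<-irrefl (cong toℕ (ρ-perm (trans (inject₁-fromℕ≤⇒≡ x≤fj) (sym (inject₁-fromℕ≤⇒≡ x≤fl))))) j<l

    <x⇒<max : ∀ {j} → f j < x → ∀ {q} → f q ≡ fromℕ m → f j < f q
    <x⇒<max fj<x fq≡max = subst (f _ <_) (sym fq≡max) (<-inject₁⁻ fj<x)

    <x⇒≢max : ∀ {j} → f j < x → ∀ {q} → f q ≡ fromℕ m → j ≢ q
    <x⇒≢max fj<x fq≡max refl = ℕₚ.<-irrefl refl (<x⇒<max fj<x fq≡max)

  insertBelow-⋠⇒≡max : ∀ {v} → p123 ⋠ insertBelow v ρ → p132 ⋠ insertBelow v ρ → v ≡ fromℕ m
  insertBelow-⋠⇒≡max {v} 123⋠ 132⋠ with Finₚ.<-cmp v (fromℕ m)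
  ... | tri≈ _ v≡max _ = v≡max
  ... | tri> _ _ max<v = ⊥-elim (fromℕ-maximal v max<v)
  ... | tri< v<max _ _ with position v | position (fromℕ m)
  ...   | a , fa≡v | b , fb≡max with Finₚ.<-cmp a b
  ...     | tri< a<b _ _ = ⊥-elim (123⋠ (P123.head (a , b , a<b , fa<fb , x≤fa , x≤fb)))
    where
    fa<fb = subst₂ _<_ (sym fa≡v) (sym fb≡max) v<max
    x≤fa = inject₁-≤ (ℕₚ.≤-reflexive (cong toℕ (sym fa≡v)))
    x≤fb = inject₁-≤ (subst (v Fin.≤_) (sym fb≡max) (ℕₚ.<⇒≤ v<max))
  ...     | tri≈ _ refl _ = ⊥-elim (ℕₚ.<-irrefl (cong toℕ (trans (sym fa≡v) fb≡max)) v<max)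
  ...     | tri> _ _ b<a = ⊥-elim (132⋠ (P132.head (b , a , b<a , fa<fb , x≤fb , x≤fa)))
    where
    fa<fb = subst₂ _<_ (sym fa≡v) (sym fb≡max) v<max
    x≤fa = inject₁-≤ (ℕₚ.≤-reflexive (cong toℕ (sym fa≡v)))
    x≤fb = inject₁-≤ (subst (v Fin.≤_) (sym fb≡max) (ℕₚ.<⇒≤ v<max))

  belowMax-⋠123 : p123 ⋠ ρ → p123 ⋠ belowMax ρ
  belowMax-⋠123 123⋠ c with P123.split x ρ c
  ... | inj₁ c′ = 123⋠ c′
  ... | inj₂ (j , l , j<l , _ , x≤fj , x≤fl) = no-two-maxima j<l x≤fj x≤fl

  belowMax-⋠132 : p132 ⋠ ρ → p132 ⋠ belowMax ρ
  belowMax-⋠132 132⋠ c with P132.split x ρ c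
  ... | inj₁ c′ = 132⋠ c′
  ... | inj₂ (j , l , j<l , _ , x≤fj , x≤fl) = no-two-maxima j<l x≤fj x≤fl

  -- An occurrence of 312 using the new head can be moved to the maximum of ρ,
  -- unless the maximum lies between its 1 and 2 (a 132) or after them (a 123).
  belowMax-⋠312 : p123 ⋠ ρ → p132 ⋠ ρ → p312 ⋠ ρ → p312 ⋠ belowMax ρ
  belowMax-⋠312 123⋠ 132⋠ 312⋠ c with P312.split x ρ c
  ... | inj₁ c′ = 312⋠ c′
  ... | inj₂ (j , l , j<l , fj<fl , fj<x , fl<x) with position (fromℕ m)
  ...   | q , fq≡max with Finₚ.<-cmp q j
  ...     | tri< q<j _ _ = 312⋠ (P312.intro (q , j , l , q<j , j<l , fj<fq , fl<fq , fj<fl))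
    where
    fj<fq = <x⇒<max fj<x fq≡max
    fl<fq = <x⇒<max fl<x fq≡max
  ...     | tri≈ _ j≡q _ = <x⇒≢max fj<x fq≡max (sym j≡q)
  ...     | tri> _ _ j<q with Finₚ.<-cmp q l
  ...       | tri< q<l _ _ = 132⋠ (P132.intro (j , q , l , j<q , q<l , <x⇒<max fj<x fq≡max , fj<fl , <x⇒<max fl<x fq≡max))
  ...       | tri≈ _ l≡q _ = <x⇒≢max fl<x fq≡max (sym l≡q)
  ...       | tri> _ _ l<q = 123⋠ (P123.intro (j , l , q , j<l , l<q , fj<fl , <x⇒<max fj<x fq≡max , <x⇒<max fl<x fq≡max))

  belowMax-⋠⇒⋠312 : p3412 ⋠ belowMax ρ → p123 ⋠ ρ → p132 ⋠ ρ → p312 ⋠ ρ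
  belowMax-⋠⇒⋠312 3412⋠ 123⋠ 132⋠ c with P312.elim c
  ... | i , j , l , i<j , j<l , fj<fi , fl<fi , fj<fl with position (fromℕ m)
  ...   | q , fq≡max with Finₚ.<-cmp q j
  ...     | tri< q<j _ _ = 3412⋠ (P3412.head (q , j , l , q<j , j<l , fj<fq , fl<fq , fj<fl ,
            inject₁-≤ (subst (fromℕ m Fin.≤_) (sym fq≡max) ℕₚ.≤-refl) , <-inject₁ (subst (f j <_) fq≡max fj<fq) ,
            <-inject₁ (subst (f l <_) fq≡max fl<fq)))
    where
    fj<fq = <-max ρ ρ-perm fq≡max λ { refl → ℕₚ.<-irrefl refl q<j }
    fl<fq = <-max ρ ρ-perm fq≡max λ { refl → ℕₚ.<-asym q<j j<l }
  ...     | tri≈ _ refl _ = fromℕ-maximal (f i) (subst (_< f i) fq≡max fj<fi)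
  ...     | tri> _ _ j<q with Finₚ.<-cmp q l
  ...       | tri< q<l _ _ = 132⋠ (P132.intro (j , q , l , j<q , q<l ,
              <-max ρ ρ-perm fq≡max (λ { refl → ℕₚ.<-irrefl refl j<q }) , fj<fl ,
              <-max ρ ρ-perm fq≡max (λ { refl → ℕₚ.<-irrefl refl q<l })))
  ...       | tri≈ _ refl _ = fromℕ-maximal (f i) (subst (_< f i) fq≡max fl<fi)
  ...       | tri> _ _ l<q = 123⋠ (P123.intro (j , l , q , j<l , l<q , fj<fl ,
              <-max ρ ρ-perm fq≡max (λ { refl → ℕₚ.<-irrefl refl (ℕₚ.<-trans j<l l<q) }) ,
              <-max ρ ρ-perm fq≡max (λ { refl → ℕₚ.<-irrefl refl l<q })))

  belowMax-⋠4231 : p123 ⋠ ρ → p132 ⋠ ρ → p4231 ⋠ ρ → p4231 ⋠ belowMax ρ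
  belowMax-⋠4231 123⋠ 132⋠ 4231⋠ c with P4231.split x ρ c
  ... | inj₁ c′ = 4231⋠ c′
  ... | inj₂ (j , l , p , j<l , l<p , fj<fl , fp<fj , fp<fl , fj<x , fl<x , fp<x) with position (fromℕ m)
  ...   | q , fq≡max with Finₚ.<-cmp q j
  ...     | tri< q<j _ _ = 4231⋠ (P4231.intro (q , j , l , p , q<j , j<l , l<p ,
            <x⇒<max fj<x fq≡max , <x⇒<max fl<x fq≡max , <x⇒<max fp<x fq≡max , fj<fl , fp<fj , fp<fl))
  ...     | tri≈ _ j≡q _ = <x⇒≢max fj<x fq≡max (sym j≡q)
  ...     | tri> _ _ j<q with Finₚ.<-cmp q l
  ...       | tri< q<l _ _ = 132⋠ (P132.intro (j , q , l , j<q , q<l , <x⇒<max fj<x fq≡max , fj<fl , <x⇒<max fl<x fq≡max))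
  ...       | tri≈ _ l≡q _ = <x⇒≢max fl<x fq≡max (sym l≡q)
  ...       | tri> _ _ l<q = 123⋠ (P123.intro (j , l , q , j<l , l<q , fj<fl , <x⇒<max fj<x fq≡max , <x⇒<max fl<x fq≡max))

EndsWithMax : ∀ {m} → Perm (suc m) → Set
EndsWithMax {m} ρ = lookup ρ (fromℕ m) ≡ fromℕ m

maxFirst-¬endsWithMax : ∀ {m} (ρ : Perm (suc m)) → ¬ EndsWithMax (maxFirst ρ)
maxFirst-¬endsWithMax {m} ρ ends =
  Finₚ.punchInᵢ≢i (fromℕ (suc m)) (lookup ρ (fromℕ m)) (trans (sym (lookup-◂ _ ρ (suc (fromℕ m)))) ends)

belowMax-endsWithMax : ∀ {m} (ρ : Perm (suc m)) → EndsWithMax ρ → EndsWithMax (belowMax ρ)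
belowMax-endsWithMax {m} ρ ends = trans (lookup-◂ x ρ (suc (fromℕ m))) (Finₚ.toℕ-injective (begin
  toℕ (punchIn x (lookup ρ (fromℕ m)))   ≡⟨ punchIn-above x _ (subst (x Fin.≤_) (sym ends) (inject₁-≤ ℕₚ.≤-refl)) ⟩
  suc (toℕ (lookup ρ (fromℕ m)))         ≡⟨ cong (suc ∘ toℕ) ends ⟩
  suc (toℕ (fromℕ m))                    ∎))
  where
  x = inject₁ (fromℕ m)
  open ≡-Reasoning

module _ {m} (ρ : Perm (suc m)) (ρ-perm : IsPerm ρ) where

  open Entries ρ ρ-perm

  private
    x = inject₁ (fromℕ m)

  belowMax-⋠231 : EndsWithMax ρ → p231 ⋠ ρ → p231 ⋠ belowMax ρ
  belowMax-⋠231 ends 231⋠ c with P231.split x ρ c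
  ... | inj₁ c′ = 231⋠ c′
  ... | inj₂ (j , l , j<l , _ , x≤fj , _) = <⇒≢last j<l (ρ-perm (trans (inject₁-fromℕ≤⇒≡ x≤fj) (sym ends)))

  -- If the maximum of ρ is not last, it forms a 231 with the last entry and the new head.
  belowMax-⋠231⇒endsWithMax : p231 ⋠ belowMax ρ → EndsWithMax ρ
  belowMax-⋠231⇒endsWithMax 231⋠ with lookup ρ last Fin.≟ fromℕ m
  ... | yes ends = ends
  ... | no ¬ends with position (fromℕ m)
  ...   | q , fq≡max = ⊥-elim (231⋠ (P231.head (q , last , ≢last⇒< q≢last ,
          <-max ρ ρ-perm fq≡max (q≢last ∘ sym) , inject₁-≤ (subst (fromℕ m Fin.≤_) (sym fq≡max) ℕₚ.≤-refl) ,
          <-inject₁ (Finₚ.≤∧≢⇒< (Finₚ.≤fromℕ _) ¬ends))))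
    where
    q≢last : q ≢ last
    q≢last refl = ¬ends fq≡max

maxFirst-or-belowMax : ∀ {m} {π : Perm (suc (suc m))} → IsPerm π → p123 ⋠ π → p132 ⋠ π →
  ∃ λ ρ → IsPerm ρ × (π ≡ maxFirst ρ ⊎ π ≡ belowMax ρ)
maxFirst-or-belowMax π-perm 123⋠ 132⋠ with maxFirst-or-insertBelow π-perm
... | ρ , ρ-perm , inj₁ π≡ = ρ , ρ-perm , inj₁ π≡
... | ρ , ρ-perm , inj₂ (v , refl) =
      ρ , ρ-perm , inj₂ (cong (λ v → insertBelow v ρ) (insertBelow-⋠⇒≡max ρ ρ-perm 123⋠ 132⋠))

grows-123-132-12 : Grows (Avoiding p123 p132 p12) (Avoiding p123 p132 (zero ∷ [])) maxFirst belowMax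
grows-123-132-12 = record
  { base = avoiding-singleton
  ; old-injective = maxFirst-injective
  ; new-injective = prependBelow-injective maxEntry
  ; old≢new = maxFirst≢prependBelow maxEntry
  ; old-closed = avoiding-maxFirst p123-startsBelowMax p132-startsBelowMax p12-startsBelowMax
  ; new-closed = λ A → ⊥-elim (avoids₃ A (singleton-≼ _))
  ; decompose = decompose
  }
  where
  decompose : Decomposition (Avoiding p123 p132 p12) (Avoiding p123 p132 (zero ∷ [])) maxFirst belowMax
  decompose A with maxFirst-or-belowMax (isPerm A) (avoids₁ A) (avoids₂ A)
  ... | ρ , ρ-perm , inj₁ refl = inj₁ (ρ , avoiding-◂⁻ ρ-perm A , refl)
  ... | ρ , ρ-perm , inj₂ refl = ⊥-elim (avoids₃ A (p12-≼-insertBelow ρ ρ-perm _))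

grows-123-132-312 : Grows (Avoiding p123 p132 p312) (Avoiding p123 p132 p12) belowMax maxFirst
grows-123-132-312 = record
  { base = avoiding-singleton
  ; old-injective = prependBelow-injective maxEntry
  ; new-injective = maxFirst-injective
  ; old≢new = λ ρ σ → maxFirst≢prependBelow maxEntry σ ρ ∘ sym
  ; old-closed = λ { (avoiding ρ-perm 123⋠ 132⋠ 312⋠) → avoiding (◂-isPerm _ _ ρ-perm)
      (belowMax-⋠123 _ ρ-perm 123⋠) (belowMax-⋠132 _ ρ-perm 132⋠) (belowMax-⋠312 _ ρ-perm 123⋠ 132⋠ 312⋠) }
  ; new-closed = avoiding-maxFirst-maxFirst p123-startsBelowMax p132-startsBelowMax
  ; decompose = decompose
  }
  where
  decompose : Decomposition (Avoiding p123 p132 p312) (Avoiding p123 p132 p12) belowMax maxFirst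
  decompose A with maxFirst-or-belowMax (isPerm A) (avoids₁ A) (avoids₂ A)
  ... | ρ , ρ-perm , inj₁ refl = inj₂ (ρ , avoiding-maxFirst-maxFirst⁻ ρ-perm A , refl)
  ... | ρ , ρ-perm , inj₂ refl = inj₁ (ρ , avoiding-◂⁻ ρ-perm A , refl)

grows-123-132-3412 : Grows (Avoiding p123 p132 p3412) (Avoiding p123 p132 p312) maxFirst belowMax
grows-123-132-3412 = record
  { base = avoiding-singleton
  ; old-injective = maxFirst-injective
  ; new-injective = prependBelow-injective maxEntry
  ; old≢new = maxFirst≢prependBelow maxEntry
  ; old-closed = avoiding-maxFirst p123-startsBelowMax p132-startsBelowMax p3412-startsBelowMax
  ; new-closed = λ { (avoiding ρ-perm 123⋠ 132⋠ 312⋠) → avoiding (◂-isPerm _ _ ρ-perm)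
      (belowMax-⋠123 _ ρ-perm 123⋠) (belowMax-⋠132 _ ρ-perm 132⋠) (◂-⋠-◂ {s = # 2} 312⋠) }
  ; decompose = decompose
  }
  where
  decompose : Decomposition (Avoiding p123 p132 p3412) (Avoiding p123 p132 p312) maxFirst belowMax
  decompose A with maxFirst-or-belowMax (isPerm A) (avoids₁ A) (avoids₂ A)
  ... | ρ , ρ-perm , inj₁ refl = inj₁ (ρ , avoiding-◂⁻ ρ-perm A , refl)
  ... | ρ , ρ-perm , inj₂ refl = inj₂ (ρ , avoiding ρ-perm (⋠-◂⁻ (avoids₁ A)) (⋠-◂⁻ (avoids₂ A))
          (belowMax-⋠⇒⋠312 ρ ρ-perm (avoids₃ A) (⋠-◂⁻ (avoids₁ A)) (⋠-◂⁻ (avoids₂ A))) , refl)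

enumeration-123-132-3412 : Enumeration (Avoiding p123 p132 p3412) count₂
enumeration-123-132-3412 = enumeration-from-growths grows-123-132-12 grows-123-132-312 grows-123-132-3412

AvoidingEndingWithMax : Class
AvoidingEndingWithMax π = Avoiding p123 p132 p231 π × EndsWithMax π

grows-123-132-231-endsWithMax : Grows AvoidingEndingWithMax (Avoiding p123 p132 (zero ∷ [])) belowMax maxFirst
grows-123-132-231-endsWithMax = record
  { base = avoiding-singleton , refl
  ; old-injective = prependBelow-injective maxEntry
  ; new-injective = maxFirst-injective
  ; old≢new = λ ρ σ → maxFirst≢prependBelow maxEntry σ ρ ∘ sym
  ; old-closed = λ {_} {ρ} → λ { (avoiding ρ-perm 123⋠ 132⋠ 231⋠ , ends) → avoiding (◂-isPerm _ _ ρ-perm)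
      (belowMax-⋠123 _ ρ-perm 123⋠) (belowMax-⋠132 _ ρ-perm 132⋠) (belowMax-⋠231 _ ρ-perm ends 231⋠) ,
      belowMax-endsWithMax ρ ends }
  ; new-closed = λ A → ⊥-elim (avoids₃ A (singleton-≼ _))
  ; decompose = decompose
  }
  where
  decompose : Decomposition AvoidingEndingWithMax (Avoiding p123 p132 (zero ∷ [])) belowMax maxFirst
  decompose (A , ends) with maxFirst-or-belowMax (isPerm A) (avoids₁ A) (avoids₂ A)
  ... | ρ , ρ-perm , inj₁ refl = ⊥-elim (maxFirst-¬endsWithMax ρ ends)
  ... | ρ , ρ-perm , inj₂ refl = inj₁ (ρ , (avoiding-◂⁻ ρ-perm A , belowMax-⋠231⇒endsWithMax ρ ρ-perm (avoids₃ A)) , refl)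

grows-123-132-231 : Grows (Avoiding p123 p132 p231) AvoidingEndingWithMax maxFirst belowMax
grows-123-132-231 = record
  { base = avoiding-singleton
  ; old-injective = maxFirst-injective
  ; new-injective = prependBelow-injective maxEntry
  ; old≢new = maxFirst≢prependBelow maxEntry
  ; old-closed = avoiding-maxFirst p123-startsBelowMax p132-startsBelowMax p231-startsBelowMax
  ; new-closed = λ { (avoiding ρ-perm 123⋠ 132⋠ 231⋠ , ends) → avoiding (◂-isPerm _ _ ρ-perm)
      (belowMax-⋠123 _ ρ-perm 123⋠) (belowMax-⋠132 _ ρ-perm 132⋠) (belowMax-⋠231 _ ρ-perm ends 231⋠) }
  ; decompose = decompose
  }
  where
  decompose : Decomposition (Avoiding p123 p132 p231) AvoidingEndingWithMax maxFirst belowMax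
  decompose A with maxFirst-or-belowMax (isPerm A) (avoids₁ A) (avoids₂ A)
  ... | ρ , ρ-perm , inj₁ refl = inj₁ (ρ , avoiding-◂⁻ ρ-perm A , refl)
  ... | ρ , ρ-perm , inj₂ refl = inj₂ (ρ , (avoiding-◂⁻ ρ-perm A , belowMax-⋠231⇒endsWithMax ρ ρ-perm (avoids₃ A)) , refl)

grows-123-132-4231 : Grows (Avoiding p123 p132 p4231) (Avoiding p123 p132 p231) belowMax maxFirst
grows-123-132-4231 = record
  { base = avoiding-singleton
  ; old-injective = prependBelow-injective maxEntry
  ; new-injective = maxFirst-injective
  ; old≢new = λ ρ σ → maxFirst≢prependBelow maxEntry σ ρ ∘ sym
  ; old-closed = λ { (avoiding ρ-perm 123⋠ 132⋠ 4231⋠) → avoiding (◂-isPerm _ _ ρ-perm)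
      (belowMax-⋠123 _ ρ-perm 123⋠) (belowMax-⋠132 _ ρ-perm 132⋠) (belowMax-⋠4231 _ ρ-perm 123⋠ 132⋠ 4231⋠) }
  ; new-closed = avoiding-maxFirst-maxFirst p123-startsBelowMax p132-startsBelowMax
  ; decompose = decompose
  }
  where
  decompose : Decomposition (Avoiding p123 p132 p4231) (Avoiding p123 p132 p231) belowMax maxFirst
  decompose A with maxFirst-or-belowMax (isPerm A) (avoids₁ A) (avoids₂ A)
  ... | ρ , ρ-perm , inj₁ refl = inj₂ (ρ , avoiding-maxFirst-maxFirst⁻ ρ-perm A , refl)
  ... | ρ , ρ-perm , inj₂ refl = inj₁ (ρ , avoiding-◂⁻ ρ-perm A , refl)

enumeration-123-132-4231 : Enumeration (Avoiding p123 p132 p4231) count₂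
enumeration-123-132-4231 = enumeration-from-growths grows-123-132-231-endsWithMax grows-123-132-231 grows-123-132-4231

-- Av(132, 213)

-- The new head of belowFirst ρ lies just below the first entry of ρ, which directly follows
-- it; so in an occurrence using the head, the head can be replaced by that first entry.
module _ {m} (ρ : Perm (suc m)) (ρ-perm : IsPerm ρ) where

  open Entries ρ ρ-perm

  private
    f = lookup ρ
    w = lookup ρ zero
    x = inject₁ w

    <w⇒0< : ∀ {j} → f j < w → zero {m} < j
    <w⇒0< {j} fj<w = ≢0⇒0< λ { refl → ℕₚ.<-irrefl refl fj<w }

    x≤⇒w< : ∀ {j l : Fin (suc m)} → j < l → x Fin.≤ f l → w < f l
    x≤⇒w< {l = l} j<l x≤fl = ℕₚ.≤∧≢⇒< (inject₁-≤⁻ x≤fl) (distinct {zero} {l} (λ { refl → ℕₚ.n≮0 j<l }))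

  insertBelow-⋠⇒≡first : ∀ {v} → p132 ⋠ insertBelow v ρ → p213 ⋠ insertBelow v ρ → v ≡ w
  insertBelow-⋠⇒≡first {v} 132⋠ 213⋠ with position v | Finₚ.<-cmp v w
  ... | _ | tri≈ _ v≡w _ = v≡w
  ... | l , fl≡v | tri< v<w _ _ = ⊥-elim (132⋠ (P132.head (zero , l , <w⇒0< fl<w , fl<w ,
        inject₁-≤ (ℕₚ.<⇒≤ v<w) , inject₁-≤ (ℕₚ.≤-reflexive (cong toℕ (sym fl≡v))))))
    where fl<w = subst (_< w) (sym fl≡v) v<w
  ... | l , fl≡v | tri> _ _ w<v = ⊥-elim (213⋠ (P213.head (zero , l , ≢0⇒0< l≢0 , w<fl ,
        <-inject₁ w<v , inject₁-≤ (ℕₚ.≤-reflexive (cong toℕ (sym fl≡v))))))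
    where
    w<fl = subst (w <_) (sym fl≡v) w<v
    l≢0 : l ≢ zero
    l≢0 refl = ℕₚ.<-irrefl refl w<fl

  belowFirst-⋠132 : p132 ⋠ ρ → p132 ⋠ belowFirst ρ
  belowFirst-⋠132 132⋠ c with P132.split x ρ c
  ... | inj₁ c′ = 132⋠ c′
  ... | inj₂ (j , l , j<l , fl<fj , _ , x≤fl) =
        132⋠ (P132.intro (zero , j , l , ≢0⇒0< j≢0 , j<l , ℕₚ.<-trans w<fl fl<fj , w<fl , fl<fj))
    where
    w<fl = x≤⇒w< j<l x≤fl
    j≢0 : j ≢ zero
    j≢0 refl = ℕₚ.<-asym w<fl fl<fj

  belowFirst-⋠213 : p213 ⋠ ρ → p213 ⋠ belowFirst ρ
  belowFirst-⋠213 213⋠ c with P213.split x ρ c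
  ... | inj₁ c′ = 213⋠ c′
  ... | inj₂ (j , l , j<l , fj<fl , fj<x , x≤fl) =
        213⋠ (P213.intro (zero , j , l , <w⇒0< fj<w , j<l , fj<w , x≤⇒w< j<l x≤fl , fj<fl))
    where fj<w = <-inject₁⁻ fj<x

  belowFirst-⋠21 : p21 ⋠ ρ → p21 ⋠ belowFirst ρ
  belowFirst-⋠21 21⋠ c with P21.split x ρ c
  ... | inj₁ c′ = 21⋠ c′
  ... | inj₂ (j , fj<x) = 21⋠ (P21.intro (zero , j , <w⇒0< (<-inject₁⁻ fj<x) , <-inject₁⁻ fj<x))

  belowFirst-⋠312 : p312 ⋠ ρ → p312 ⋠ belowFirst ρ
  belowFirst-⋠312 312⋠ c with P312.split x ρ c
  ... | inj₁ c′ = 312⋠ c′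
  ... | inj₂ (j , l , j<l , fj<fl , fj<x , fl<x) =
        312⋠ (P312.intro (zero , j , l , <w⇒0< (<-inject₁⁻ fj<x) , j<l , <-inject₁⁻ fj<x , <-inject₁⁻ fl<x , fj<fl))

  belowFirst-⋠321 : p321 ⋠ ρ → p321 ⋠ belowFirst ρ
  belowFirst-⋠321 321⋠ c with P321.split x ρ c
  ... | inj₁ c′ = 321⋠ c′
  ... | inj₂ (j , l , j<l , fl<fj , fj<x , fl<x) =
        321⋠ (P321.intro (zero , j , l , <w⇒0< (<-inject₁⁻ fj<x) , j<l , <-inject₁⁻ fj<x , <-inject₁⁻ fl<x , fl<fj))

  belowFirst-⋠4321 : p4321 ⋠ ρ → p4321 ⋠ belowFirst ρ
  belowFirst-⋠4321 4321⋠ c with P4321.split x ρ c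
  ... | inj₁ c′ = 4321⋠ c′
  ... | inj₂ (j , l , p , j<l , l<p , fl<fj , fp<fj , fp<fl , fj<x , fl<x , fp<x) =
        4321⋠ (P4321.intro (zero , j , l , p , <w⇒0< (<-inject₁⁻ fj<x) , j<l , l<p ,
          <-inject₁⁻ fj<x , <-inject₁⁻ fl<x , <-inject₁⁻ fp<x , fl<fj , fp<fj , fp<fl))

  belowFirst-⋠⇒⋠312 : p3412 ⋠ belowFirst ρ → p132 ⋠ ρ → p213 ⋠ ρ → p312 ⋠ ρ
  belowFirst-⋠⇒⋠312 3412⋠ 132⋠ 213⋠ c with P312.elim c
  ... | i , j , l , i<j , j<l , fj<fi , fl<fi , fj<fl with Finₚ.<-cmp (f l) w
  ...   | tri< fl<w _ _ = 3412⋠ (P3412.head (zero , j , l , <⇒0< i<j , j<l , ℕₚ.<-trans fj<fl fl<w , fl<w , fj<fl ,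
          inject₁-≤ ℕₚ.≤-refl , <-inject₁ (ℕₚ.<-trans fj<fl fl<w) , <-inject₁ fl<w))
  ...   | tri≈ _ fl≡w _ = ℕₚ.n≮0 (subst (j <_) (ρ-perm fl≡w) j<l)
  ...   | tri> _ _ w<fl with Finₚ.<-cmp (f j) w
  ...     | tri< fj<w _ _ = 213⋠ (P213.intro (zero , j , l , <⇒0< i<j , j<l , fj<w , w<fl , fj<fl))
  ...     | tri≈ _ fj≡w _ = ℕₚ.n≮0 (subst (i <_) (ρ-perm fj≡w) i<j)
  ...     | tri> _ _ w<fj = 132⋠ (P132.intro (zero , i , j , ≢0⇒0< i≢0 , i<j , ℕₚ.<-trans w<fj fj<fi , w<fj , fj<fi))
    where
    i≢0 : i ≢ zero
    i≢0 refl = ℕₚ.<-asym w<fj fj<fi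

maxFirst-or-belowFirst : ∀ {m} {π : Perm (suc (suc m))} → IsPerm π → p132 ⋠ π → p213 ⋠ π →
  ∃ λ ρ → IsPerm ρ × (π ≡ maxFirst ρ ⊎ π ≡ belowFirst ρ)
maxFirst-or-belowFirst π-perm 132⋠ 213⋠ with maxFirst-or-insertBelow π-perm
... | ρ , ρ-perm , inj₁ π≡ = ρ , ρ-perm , inj₁ π≡
... | ρ , ρ-perm , inj₂ (v , refl) =
      ρ , ρ-perm , inj₂ (cong (λ v → insertBelow v ρ) (insertBelow-⋠⇒≡first ρ ρ-perm 132⋠ 213⋠))

grows-132-213-12 : Grows (Avoiding p132 p213 p12) (Avoiding p132 p213 (zero ∷ [])) maxFirst belowFirst
grows-132-213-12 = record
  { base = avoiding-singleton
  ; old-injective = maxFirst-injective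
  ; new-injective = prependBelow-injective firstEntry
  ; old≢new = maxFirst≢prependBelow firstEntry
  ; old-closed = avoiding-maxFirst p132-startsBelowMax p213-startsBelowMax p12-startsBelowMax
  ; new-closed = λ A → ⊥-elim (avoids₃ A (singleton-≼ _))
  ; decompose = decompose
  }
  where
  decompose : Decomposition (Avoiding p132 p213 p12) (Avoiding p132 p213 (zero ∷ [])) maxFirst belowFirst
  decompose A with maxFirst-or-belowFirst (isPerm A) (avoids₁ A) (avoids₂ A)
  ... | ρ , ρ-perm , inj₁ refl = inj₁ (ρ , avoiding-◂⁻ ρ-perm A , refl)
  ... | ρ , ρ-perm , inj₂ refl = ⊥-elim (avoids₃ A (p12-≼-insertBelow ρ ρ-perm _))

grows-132-213-312 : Grows (Avoiding p132 p213 p312) (Avoiding p132 p213 p12) belowFirst maxFirst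
grows-132-213-312 = record
  { base = avoiding-singleton
  ; old-injective = prependBelow-injective firstEntry
  ; new-injective = maxFirst-injective
  ; old≢new = λ ρ σ → maxFirst≢prependBelow firstEntry σ ρ ∘ sym
  ; old-closed = λ { (avoiding ρ-perm 132⋠ 213⋠ 312⋠) → avoiding (◂-isPerm _ _ ρ-perm)
      (belowFirst-⋠132 _ ρ-perm 132⋠) (belowFirst-⋠213 _ ρ-perm 213⋠) (belowFirst-⋠312 _ ρ-perm 312⋠) }
  ; new-closed = avoiding-maxFirst-maxFirst p132-startsBelowMax p213-startsBelowMax
  ; decompose = decompose
  }
  where
  decompose : Decomposition (Avoiding p132 p213 p312) (Avoiding p132 p213 p12) belowFirst maxFirst
  decompose A with maxFirst-or-belowFirst (isPerm A) (avoids₁ A) (avoids₂ A)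
  ... | ρ , ρ-perm , inj₁ refl = inj₂ (ρ , avoiding-maxFirst-maxFirst⁻ ρ-perm A , refl)
  ... | ρ , ρ-perm , inj₂ refl = inj₁ (ρ , avoiding-◂⁻ ρ-perm A , refl)

grows-132-213-3412 : Grows (Avoiding p132 p213 p3412) (Avoiding p132 p213 p312) maxFirst belowFirst
grows-132-213-3412 = record
  { base = avoiding-singleton
  ; old-injective = maxFirst-injective
  ; new-injective = prependBelow-injective firstEntry
  ; old≢new = maxFirst≢prependBelow firstEntry
  ; old-closed = avoiding-maxFirst p132-startsBelowMax p213-startsBelowMax p3412-startsBelowMax
  ; new-closed = λ { (avoiding ρ-perm 132⋠ 213⋠ 312⋠) → avoiding (◂-isPerm _ _ ρ-perm)
      (belowFirst-⋠132 _ ρ-perm 132⋠) (belowFirst-⋠213 _ ρ-perm 213⋠) (◂-⋠-◂ {s = # 2} 312⋠) }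
  ; decompose = decompose
  }
  where
  decompose : Decomposition (Avoiding p132 p213 p3412) (Avoiding p132 p213 p312) maxFirst belowFirst
  decompose A with maxFirst-or-belowFirst (isPerm A) (avoids₁ A) (avoids₂ A)
  ... | ρ , ρ-perm , inj₁ refl = inj₁ (ρ , avoiding-◂⁻ ρ-perm A , refl)
  ... | ρ , ρ-perm , inj₂ refl = inj₂ (ρ , avoiding ρ-perm (⋠-◂⁻ (avoids₁ A)) (⋠-◂⁻ (avoids₂ A))
          (belowFirst-⋠⇒⋠312 ρ ρ-perm (avoids₃ A) (⋠-◂⁻ (avoids₁ A)) (⋠-◂⁻ (avoids₂ A))) , refl)

enumeration-132-213-3412 : Enumeration (Avoiding p132 p213 p3412) count₂
enumeration-132-213-3412 = enumeration-from-growths grows-132-213-12 grows-132-213-312 grows-132-213-3412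

grows-132-213-21 : Grows (Avoiding p132 p213 p21) (Avoiding p132 p213 (zero ∷ [])) belowFirst maxFirst
grows-132-213-21 = record
  { base = avoiding-singleton
  ; old-injective = prependBelow-injective firstEntry
  ; new-injective = maxFirst-injective
  ; old≢new = λ ρ σ → maxFirst≢prependBelow firstEntry σ ρ ∘ sym
  ; old-closed = λ { (avoiding ρ-perm 132⋠ 213⋠ 21⋠) → avoiding (◂-isPerm _ _ ρ-perm)
      (belowFirst-⋠132 _ ρ-perm 132⋠) (belowFirst-⋠213 _ ρ-perm 213⋠) (belowFirst-⋠21 _ ρ-perm 21⋠) }
  ; new-closed = λ A → ⊥-elim (avoids₃ A (singleton-≼ _))
  ; decompose = decompose
  }
  where
  decompose : Decomposition (Avoiding p132 p213 p21) (Avoiding p132 p213 (zero ∷ [])) belowFirst maxFirst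
  decompose A with maxFirst-or-belowFirst (isPerm A) (avoids₁ A) (avoids₂ A)
  ... | ρ , ρ-perm , inj₁ refl = ⊥-elim (avoids₃ A (maxFirst-≼-maxFirst (singleton-≼ ρ)))
  ... | ρ , ρ-perm , inj₂ refl = inj₁ (ρ , avoiding-◂⁻ ρ-perm A , refl)

grows-132-213-321 : Grows (Avoiding p132 p213 p321) (Avoiding p132 p213 p21) belowFirst maxFirst
grows-132-213-321 = record
  { base = avoiding-singleton
  ; old-injective = prependBelow-injective firstEntry
  ; new-injective = maxFirst-injective
  ; old≢new = λ ρ σ → maxFirst≢prependBelow firstEntry σ ρ ∘ sym
  ; old-closed = λ { (avoiding ρ-perm 132⋠ 213⋠ 321⋠) → avoiding (◂-isPerm _ _ ρ-perm)
      (belowFirst-⋠132 _ ρ-perm 132⋠) (belowFirst-⋠213 _ ρ-perm 213⋠) (belowFirst-⋠321 _ ρ-perm 321⋠) }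
  ; new-closed = avoiding-maxFirst-maxFirst p132-startsBelowMax p213-startsBelowMax
  ; decompose = decompose
  }
  where
  decompose : Decomposition (Avoiding p132 p213 p321) (Avoiding p132 p213 p21) belowFirst maxFirst
  decompose A with maxFirst-or-belowFirst (isPerm A) (avoids₁ A) (avoids₂ A)
  ... | ρ , ρ-perm , inj₁ refl = inj₂ (ρ , avoiding-maxFirst-maxFirst⁻ ρ-perm A , refl)
  ... | ρ , ρ-perm , inj₂ refl = inj₁ (ρ , avoiding-◂⁻ ρ-perm A , refl)

grows-132-213-4321 : Grows (Avoiding p132 p213 p4321) (Avoiding p132 p213 p321) belowFirst maxFirst
grows-132-213-4321 = record
  { base = avoiding-singleton
  ; old-injective = prependBelow-injective firstEntry
  ; new-injective = maxFirst-injective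
  ; old≢new = λ ρ σ → maxFirst≢prependBelow firstEntry σ ρ ∘ sym
  ; old-closed = λ { (avoiding ρ-perm 132⋠ 213⋠ 4321⋠) → avoiding (◂-isPerm _ _ ρ-perm)
      (belowFirst-⋠132 _ ρ-perm 132⋠) (belowFirst-⋠213 _ ρ-perm 213⋠) (belowFirst-⋠4321 _ ρ-perm 4321⋠) }
  ; new-closed = avoiding-maxFirst-maxFirst p132-startsBelowMax p213-startsBelowMax
  ; decompose = decompose
  }
  where
  decompose : Decomposition (Avoiding p132 p213 p4321) (Avoiding p132 p213 p321) belowFirst maxFirst
  decompose A with maxFirst-or-belowFirst (isPerm A) (avoids₁ A) (avoids₂ A)
  ... | ρ , ρ-perm , inj₁ refl = inj₂ (ρ , avoiding-maxFirst-maxFirst⁻ ρ-perm A , refl)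
  ... | ρ , ρ-perm , inj₂ refl = inj₁ (ρ , avoiding-◂⁻ ρ-perm A , refl)

enumeration-132-213-4321 : Enumeration (Avoiding p132 p213 p4321) count₂
enumeration-132-213-4321 = enumeration-from-growths grows-132-213-21 grows-132-213-321 grows-132-213-4321

p213≼p1324 : p213 ≼ p1324
p213≼p1324 = P213.intro (# 1 , # 2 , # 3 , ℕ.s<s ℕ.z<s , ℕ.s<s (ℕ.s<s ℕ.z<s) ,
  ℕ.s<s ℕ.z<s , ℕ.s<s (ℕ.s<s ℕ.z<s) , ℕ.s<s ℕ.z<s)

p213≼p2314 : p213 ≼ p2314
p213≼p2314 = P213.intro (# 0 , # 2 , # 3 , ℕ.z<s , ℕ.s<s (ℕ.s<s ℕ.z<s) , ℕ.z<s , ℕ.s<s ℕ.z<s , ℕ.z<s)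

hasCard-213-321 : ∀ {τ : Perm 4} → p213 ≼ τ → ∀ n → 1 ≤ n → HasCard n p213 p321 τ (n C 2 + 1)
hasCard-213-321 p213≼τ n 1≤n = ↔-trans (Av3-third (inj₁ p213≼τ) (inj₁ ≼-refl)) (↔-trans Av3-complement
  (↔-trans Av3-swap (↔-trans (Av3-third (inj₂ ≼-refl) (inj₁ ≼-refl)) (enumeration⇒card enumeration-123-231 n 1≤n))))

theorem3p7 : ∀ (α₁ α₂ : Vec (Fin 3) 3) (τ : Vec (Fin 4) 4) → Case α₁ α₂ τ →
    ∀ (n : ℕ) → 1 ≤ n → HasCard n α₁ α₂ τ ((n C 2) + 1)
theorem3p7 _ _ τ (case1 .τ _ τ⊇) n 1≤n =
  ↔-trans (Av3-third (Sum.map contains⇒≼ contains⇒≼ τ⊇) (inj₁ ≼-refl)) (enumeration⇒card enumeration-123-231 n 1≤n)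
theorem3p7 _ _ _ case2a = enumeration⇒card enumeration-123-132-3412
theorem3p7 _ _ _ case2b = enumeration⇒card enumeration-123-132-4231
theorem3p7 _ _ _ case2c n 1≤n = ↔-trans (↔-trans Av3-reverse Av3-complement) (enumeration⇒card enumeration-123-132-3412 n 1≤n)
theorem3p7 _ _ _ case2d n 1≤n = ↔-trans (↔-trans Av3-reverse Av3-complement) (enumeration⇒card enumeration-123-132-4231 n 1≤n)
theorem3p7 _ _ _ case3 = enumeration⇒card enumeration-132-213-3412
theorem3p7 _ _ _ case4a = enumeration⇒card enumeration-132-231-1234
theorem3p7 _ _ _ case4b = enumeration⇒card enumeration-132-231-2134
theorem3p7 _ _ _ case4c = enumeration⇒card enumeration-132-231-3124
theorem3p7 _ _ _ case4d = enumeration⇒card enumeration-132-231-3214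
theorem3p7 _ _ _ case5 n 1≤n = ↔-trans Av3-complement (↔-trans Av3-swap (enumeration⇒card enumeration-132-231-3214 n 1≤n))
theorem3p7 _ _ _ case6a = hasCard-213-321 p213≼p1324
theorem3p7 _ _ _ case6b = hasCard-213-321 p213≼p2314
theorem3p7 _ _ _ case7 n 1≤n = ↔-trans Av3-swap (enumeration⇒card enumeration-132-213-4321 n 1≤n)
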